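{- If all the ai-cycles in an atomic flow B are fragile cycles, then there exists a cycle-free atomic flow C such that B →_bc C.
   Context: Atomic flows are directed acyclic graphs whose vertices are labelled interaction (ai↓: no upper edges, two lower edges), cointeraction or cut (ai↑: two upper edges, no lower edges), weakening, coweakening, contraction (two upper edges, one lower edge) and cocontraction (one upper edge, two lower edges), subject to a polarity-assignment condition. An ai-path is a sequence of edges formed by joining paths (sequences of adjacent edges going only down or only up) at interaction or cointeraction vertices. An ai-cycle is an ai-path from a vertex to itself in which no edge appears twice. A path from an interaction to a cointeraction vertex (or vice versa) is an ai-connection; an ai-connection consisting of a single edge is a simple edge. A fragile cycle is an ai-cycle containing a simple edge; a flow is cycle-free if it contains no ai-cycles. The reduction →_bc ("break ai-cycles") is defined inductively on flows. Base case: if B contains no fragile cycles, then B →_bc B. Inductive case: suppose B contains a simple edge 1 that belongs to an ai-cycle, going from an interaction vertex (whose other lower edge is 2) to a cointeraction vertex (whose other upper edge is 3), so that B consists of a flow A, with upper edges ε_1,…,ε_h and 2 and lower edges ε'_1,…,ε'_k and 3, together with this interaction, edge 1 and this cointeraction. Let B' be a copy of A in which edge 2 is the lower edge of a new weakening vertex (and edge 3 is a lower edge of B'), and let B'' be a copy of A in which edge 3 is the upper edge of a new coweakening vertex (and edge 2 is an upper edge of B''). If B' →_bc D' and B'' →_bc D'', then B →_bc C, where C is obtained by identifying the lower edge 3 of D' with the upper edge 2 of D'', attaching each upper edge ε_i of the result to a cocontraction vertex whose two lower edges are the copies of ε_i in D' and D'', and attaching each pair of copies of ε'_j in D' and D''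 to a contraction vertex whose lower edge is ε'_j. -}

module Defs where

open import Data.Nat using (ℕ; zero; suc)
open import Data.Fin using (Fin; zero; suc)
open import Data.Fin.Properties using () renaming (_≟_ to _≟F_)
open import Data.Bool using (Bool)
open import Data.Unit using (⊤)
open import Data.Empty using (⊥; ⊥-elim-irr)
open import Data.Sum using (_⊎_; inj₁; inj₂)
open import Data.Sum.Properties using (≡-dec)
open import Data.Product using (Σ; _×_; _,_; proj₁; proj₂; ∃; ∃-syntax)
open import Data.List using (List; []; _∷_)
open import Data.List.Membership.Propositional using (_∈_)
open import Data.List.Relation.Unary.Unique.Propositional using (Unique)
open import Relation.Nullary using (¬_; Dec; yes; no)
open import Relation.Binary using (DecidableEquality)
open import Relation.Binary.PropositionalEquality using (_≡_; _≢_; refl; sym; trans; cong; subst)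
open import Relation.Binary.Construct.Closure.Transitive using (TransClosure)

data Kind : Set where
  interaction cut weakening coweakening contraction cocontraction : Kind

upArity : Kind → ℕ
upArity interaction   = 0
upArity cut           = 2
upArity weakening     = 0
upArity coweakening   = 1
upArity contraction   = 2
upArity cocontraction = 1

lowArity : Kind → ℕ
lowArity interaction   = 2
lowArity cut           = 0
lowArity weakening     = 1
lowArity coweakening   = 0
lowArity contraction   = 1
lowArity cocontraction = 2

-- "there are exactly n elements satisfying P" (only n ≤ 2 occurs)
HasExactly : {A : Set} → ℕ → (A → Set) → Set
HasExactly 0 P = ∀ a → ¬ P a
HasExactly 1 P = Σ _ λ a → P a × (∀ b → P b → b ≡ a)
HasExactly 2 P = Σ _ λ a₁ → Σ _ λ a₂ → a₁ ≢ a₂ × P a₁ × P a₂ × (∀ b → P b → b ≡ a₁ ⊎ b ≡ a₂)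
HasExactly (suc (suc (suc _))) P = ⊥

record Sub (A : Set) (P : A → Set) : Set where
  constructor _,_
  field
    val  : A
    .prf : P val

Sub-≟ : {A : Set} {P : A → Set} → DecidableEquality A → DecidableEquality (Sub A P)
Sub-≟ _≟_ (a , _) (b , _) with a ≟ b
... | yes refl = yes refl
... | no ¬p    = no (λ eq → ¬p (cong Sub.val eq))

-- Raw (pre-)flows with h upper and k lower (boundary) edges.
-- Every edge has an upper end (a vertex, or "it is the i-th upper edge
-- of the flow") and a lower end (a vertex, or "it is the j-th lower
-- edge of the flow").  An edge e with  bot e ≡ inj₁ v  is an upper edge
-- of v; an edge with  top e ≡ inj₁ v  is a lower edge of v.

record Raw (h k : ℕ) : Set₁ where
  field
    V E   : Set
    _≟V_  : DecidableEquality V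
    kind  : V → Kind
    top   : E → V ⊎ Fin h
    bot   : E → V ⊎ Fin k
    inE   : Fin h → E

module _ {h k : ℕ} (B : Raw h k) where
  open Raw B

  Step : V → V → Set
  Step x y = Σ E λ e → top e ≡ inj₁ x × bot e ≡ inj₁ y

  Incident : V → E → Set
  Incident v e = top e ≡ inj₁ v ⊎ bot e ≡ inj₁ v

  PolRel : Kind → Bool → Bool → Set
  PolRel interaction   p q = p ≢ q
  PolRel cut           p q = p ≢ q
  PolRel weakening     p q = ⊤
  PolRel coweakening   p q = ⊤
  PolRel contraction   p q = p ≡ q
  PolRel cocontraction p q = p ≡ q

  Polarised : (E → Bool) → Set
  Polarised pol = ∀ v e e′ → Incident v e → Incident v e′ → e ≢ e′
                  → PolRel (kind v) (pol e) (pol e′)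

  data Dir : Set where
    down up : Dir

  Trav : E → Dir → V → V → Set
  Trav e down x y = top e ≡ inj₁ x × bot e ≡ inj₁ y
  Trav e up   x y = bot e ≡ inj₁ x × top e ≡ inj₁ y

  Turn : Dir → V → Dir → Set
  Turn down y down = ⊤
  Turn up   y up   = ⊤
  Turn down y up   = kind y ≡ cut
  Turn up   y down = kind y ≡ interaction

  -- AIPath x d y d′ es : ai-path from x to y through the edges es,
  -- first traversal in direction d, last in direction d′
  data AIPath : V → Dir → V → Dir → List E → Set where
    [_]   : ∀ {x y e d} → Trav e d x y → AIPath x d y d (e ∷ [])
    _∷⟨_⟩_ : ∀ {x y z e d d₁ d₂ es} → Trav e d x y → Turn d y d₁
           → AIPath y d₁ z d₂ es → AIPath x d z d₂ (e ∷ es)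

  record AICycle : Set where
    field
      start    : V
      d₁ d₂    : Dir
      edges    : List E
      path     : AIPath start d₁ start d₂ edges
      distinct : Unique edges

  SimpleEdge : E → Set
  SimpleEdge e = Σ V λ u → Σ V λ w →
    top e ≡ inj₁ u × kind u ≡ interaction × bot e ≡ inj₁ w × kind w ≡ cut

  Fragile : AICycle → Set
  Fragile c = Σ E λ e → e ∈ AICycle.edges c × SimpleEdge e

  HasFragileCycle : Set
  HasFragileCycle = Σ AICycle Fragile

  AllCyclesFragile : Set
  AllCyclesFragile = (c : AICycle) → Fragile c

  CycleFree : Set
  CycleFree = ¬ AICycle

record IsFlow {h k : ℕ} (B : Raw h k) : Set where
  open Raw B
  field
    finiteV     : Σ (List V) λ vs → ∀ v → v ∈ vs
    finiteE     : Σ (List E) λ es → ∀ e → e ∈ es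
    upperArity  : ∀ v → HasExactly (upArity (kind v)) (λ e → bot e ≡ inj₁ v)
    lowerArity  : ∀ v → HasExactly (lowArity (kind v)) (λ e → top e ≡ inj₁ v)
    inE-top     : ∀ i → top (inE i) ≡ inj₂ i
    inE-unique  : ∀ i e → top e ≡ inj₂ i → e ≡ inE i
    lowerLabels : ∀ j → HasExactly 1 (λ e → bot e ≡ inj₂ j)
    acyclic     : ∀ v → ¬ TransClosure (Step B) v v
    polarity    : Σ (E → Bool) (Polarised B)

module _ {h k : ℕ} (B : Raw h k) (wf : IsFlow B) where
  open Raw B

  cutNoLower : ∀ w → kind w ≡ cut → ∀ e → top e ≢ inj₁ w
  cutNoLower w hw = subst (λ κ → HasExactly (lowArity κ) (λ e → top e ≡ inj₁ w))
                          hw (IsFlow.lowerArity wf w)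

  interNoUpper : ∀ u → kind u ≡ interaction → ∀ e → bot e ≢ inj₁ u
  interNoUpper u hu = subst (λ κ → HasExactly (upArity κ) (λ e → bot e ≡ inj₁ u))
                            hu (IsFlow.upperArity wf u)

  private
    inj₂≢inj₁ : ∀ {i : Fin h} {u : V} → _≢_ {A = V ⊎ Fin h} (inj₂ i) (inj₁ u)
    inj₂≢inj₁ ()

  inE≢ : ∀ {u e1} → top e1 ≡ inj₁ u → ∀ i → inE i ≢ e1
  inE≢ t1 i eq = inj₂≢inj₁ (trans (sym (IsFlow.inE-top wf i)) (trans (cong top eq) t1))

  -- B′: the rest A of B (without the interaction u, the cut w and the
  -- simple edge e1), where edge 2 (the other lower edge of u) gets a new
  -- weakening vertex (we reuse the name u for it) and edge 3 (the other
  -- upper edge of w) becomes the new lower edge number zero (old lower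
  -- edge j becomes number suc j).
  module Weakened (u w : V) (e1 : E) (hw : kind w ≡ cut) (t1 : top e1 ≡ inj₁ u) where
    V′ = Sub V (_≢ w)
    E′ = Sub E (_≢ e1)

    kind′ : V′ → Kind
    kind′ (v , _) with v ≟V u
    ... | yes _ = weakening
    ... | no _  = kind v

    lift : (x : V ⊎ Fin h) → x ≢ inj₁ w → V′ ⊎ Fin h
    lift (inj₁ v) p = inj₁ (v , λ eq → p (cong inj₁ eq))
    lift (inj₂ i) p = inj₂ i

    top′ : E′ → V′ ⊎ Fin h
    top′ (e , _) = lift (top e) (cutNoLower w hw e)

    botV : V → V′ ⊎ Fin (suc k)
    botV v with v ≟V w
    ... | yes _ = inj₂ zero
    ... | no ¬p = inj₁ (v , ¬p)

    bot′ : E′ → V′ ⊎ Fin (suc k)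
    bot′ (e , _) with bot e
    ... | inj₁ v = botV v
    ... | inj₂ j = inj₂ (suc j)

    flow : Raw h (suc k)
    flow = record
      { V = V′ ; E = E′ ; _≟V_ = Sub-≟ _≟V_ ; kind = kind′
      ; top = top′ ; bot = bot′ ; inE = λ i → (inE i , inE≢ t1 i) }

  -- B″: the rest A of B, where edge 3 gets a new coweakening vertex (we
  -- reuse the name w for it) and edge 2 becomes the new upper edge
  -- number zero (old upper edge i becomes number suc i).
  module Coweakened (u w : V) (e1 e2 : E) (hu : kind u ≡ interaction)
                    (t1 : top e1 ≡ inj₁ u) (e2≢e1 : e2 ≢ e1) where
    V″ = Sub V (_≢ u)
    E″ = Sub E (_≢ e1)

    kind″ : V″ → Kind
    kind″ (v , _) with v ≟V w
    ... | yes _ = coweakening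
    ... | no _  = kind v

    lift : (x : V ⊎ Fin k) → x ≢ inj₁ u → V″ ⊎ Fin k
    lift (inj₁ v) p = inj₁ (v , λ eq → p (cong inj₁ eq))
    lift (inj₂ j) p = inj₂ j

    bot″ : E″ → V″ ⊎ Fin k
    bot″ (e , _) = lift (bot e) (interNoUpper u hu e)

    topV : V → V″ ⊎ Fin (suc h)
    topV v with v ≟V u
    ... | yes _ = inj₂ zero
    ... | no ¬p = inj₁ (v , ¬p)

    top″ : E″ → V″ ⊎ Fin (suc h)
    top″ (e , _) with top e
    ... | inj₁ v = topV v
    ... | inj₂ i = inj₂ (suc i)

    inE″ : Fin (suc h) → E″
    inE″ zero    = (e2 , e2≢e1)
    inE″ (suc i) = (inE i , inE≢ t1 i)

    flow : Raw (suc h) k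
    flow = record
      { V = V″ ; E = E″ ; _≟V_ = Sub-≟ _≟V_ ; kind = kind″
      ; top = top″ ; bot = bot″ ; inE = inE″ }

-- The flow C built from D′ and D″: lower edge 3 (number zero) of D′ is
-- identified with upper edge 2 (number zero) of D″; upper edge i of the
-- result gets a cocontraction whose lower edges are the copies of ε_i,
-- and the copies of ε′_j meet in a contraction with lower edge ε′_j.
-- Vertices:  D′ ⊎ D″ ⊎ (cocontractions, Fin h) ⊎ (contractions, Fin k).
-- Edges:     D′ ⊎ (D″ without its upper edge zero) ⊎ ε_i ⊎ ε′_j.

module Glue {h k : ℕ} (D′ : Raw h (suc k)) (D″ : Raw (suc h) k) where
  module D₁ = Raw D′
  module D₂ = Raw D″

  GV = D₁.V ⊎ (D₂.V ⊎ (Fin h ⊎ Fin k))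
  E₂ = Sub D₂.E (λ e → D₂.top e ≢ inj₂ zero)
  GE = D₁.E ⊎ (E₂ ⊎ (Fin h ⊎ Fin k))

  gkind : GV → Kind
  gkind (inj₁ v)                = D₁.kind v
  gkind (inj₂ (inj₁ v))         = D₂.kind v
  gkind (inj₂ (inj₂ (inj₁ i)))  = cocontraction
  gkind (inj₂ (inj₂ (inj₂ j)))  = contraction

  fromBot₂ : D₂.V ⊎ Fin k → GV ⊎ Fin k
  fromBot₂ (inj₁ v) = inj₁ (inj₂ (inj₁ v))
  fromBot₂ (inj₂ j) = inj₁ (inj₂ (inj₂ (inj₂ j)))

  gtop₁ : D₁.V ⊎ Fin h → GV ⊎ Fin h
  gtop₁ (inj₁ v) = inj₁ (inj₁ v)
  gtop₁ (inj₂ i) = inj₁ (inj₂ (inj₂ (inj₁ i)))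

  gbot₁ : D₁.V ⊎ Fin (suc k) → GV ⊎ Fin k
  gbot₁ (inj₁ v)       = inj₁ (inj₁ v)
  gbot₁ (inj₂ zero)    = fromBot₂ (D₂.bot (D₂.inE zero))
  gbot₁ (inj₂ (suc j)) = inj₁ (inj₂ (inj₂ (inj₂ j)))

  gtop₂ : (x : D₂.V ⊎ Fin (suc h)) → .(x ≢ inj₂ zero) → GV ⊎ Fin h
  gtop₂ (inj₁ v)       p = inj₁ (inj₂ (inj₁ v))
  gtop₂ (inj₂ zero)    p = ⊥-elim-irr (p refl)
  gtop₂ (inj₂ (suc i)) p = inj₁ (inj₂ (inj₂ (inj₁ i)))

  gtop : GE → GV ⊎ Fin h
  gtop (inj₁ e)                = gtop₁ (D₁.top e)
  gtop (inj₂ (inj₁ (e , p)))   = gtop₂ (D₂.top e) p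
  gtop (inj₂ (inj₂ (inj₁ i)))  = inj₂ i
  gtop (inj₂ (inj₂ (inj₂ j)))  = inj₁ (inj₂ (inj₂ (inj₂ j)))

  gbot : GE → GV ⊎ Fin k
  gbot (inj₁ e)                = gbot₁ (D₁.bot e)
  gbot (inj₂ (inj₁ (e , _)))   = fromBot₂ (D₂.bot e)
  gbot (inj₂ (inj₂ (inj₁ i)))  = inj₁ (inj₂ (inj₂ (inj₁ i)))
  gbot (inj₂ (inj₂ (inj₂ j)))  = inj₂ j

  flow : Raw h k
  flow = record
    { V = GV ; E = GE
    ; _≟V_ = ≡-dec D₁._≟V_ (≡-dec D₂._≟V_ (≡-dec _≟F_ _≟F_))
    ; kind = gkind ; top = gtop ; bot = gbot
    ; inE = λ i → inj₂ (inj₂ (inj₁ i)) }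

data _→bc_ : {h k : ℕ} → Raw h k → Raw h k → Set₁ where
  base : ∀ {h k} {B : Raw h k} → ¬ HasFragileCycle B → B →bc B
  step : ∀ {h k} {B : Raw h k} (wf : IsFlow B)
           (u w : Raw.V B) (e1 e2 : Raw.E B)
           (hu : Raw.kind B u ≡ interaction) (hw : Raw.kind B w ≡ cut)
           (t1 : Raw.top B e1 ≡ inj₁ u) (b1 : Raw.bot B e1 ≡ inj₁ w)
           (t2 : Raw.top B e2 ≡ inj₁ u) (e2≢e1 : e2 ≢ e1)
           (onCycle : Σ (AICycle B) λ c → e1 ∈ AICycle.edges c)
           {D′ : Raw h (suc k)} {D″ : Raw (suc h) k}
         → Weakened.flow B wf u w e1 hw t1 →bc D′
         → Coweakened.flow B wf u w e1 e2 hu t1 e2≢e1 →bc D″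
         → B →bc Glue.flow D′ D″

module Submission where

-- The proof follows the inductive definition of →bc, by induction on the
-- number of vertices of B.  If B has no ai-cycle (a decidable property, since
-- a cycle uses each of the finitely many edges at most once) then B →bc B.
-- Otherwise the chosen cycle is fragile, so it contains a simple edge 1 from
-- an interaction u to a cut w; the copies B′ and B″ of the rest A of B are
-- atomic flows with one vertex less than B in which again every ai-cycle is
-- fragile (their cycles are cycles of B, and the new (co)weakening can lie on
-- no cycle).  By induction B′ →bc D′ and B″ →bc D″ with D′, D″ cycle-free,
-- and it remains to show that the glued flow C is an atomic flow without
-- ai-cycles.  A cycle of C cannot pass through the new (co)contractions, nor
-- start at one (it would reverse its polarity); a cycle inside the copies of
-- D′ and D″ crosses from one copy to the other only along the identified edge
-- 3, which it uses at most once, so it lies in one copy, contradicting the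
-- cycle-freeness of D′ or D″.  To glue polarities we carry along the
-- invariant that C has the same polarities as B on its boundary edges.

open import Defs
open import Data.Nat using (ℕ; zero; suc; _≤_; _<_; z≤n; s≤s)
open import Data.Nat.Properties using (≤-refl; ≤-trans; ≤-pred; <-≤-trans; ≤-<-trans; m≤n⇒m≤1+n)
open import Data.Fin using (Fin; zero; suc)
import Data.Fin.Properties as Fin
open import Data.Bool using (Bool; true; false; not; _xor_)
open import Data.Bool.Properties using (¬-not; not-¬; xor-assoc; xor-identityʳ; xor-same)
open import Data.Unit using (⊤; tt)
open import Data.Empty using (⊥; ⊥-elim; ⊥-elim-irr)
open import Data.Sum using (_⊎_; inj₁; inj₂)
open import Data.Sum.Properties using (≡-dec; inj₁-injective; inj₂-injective)
open import Data.Product using (Σ; ∃; _×_; _,_; proj₁; proj₂)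
open import Data.List using (List; []; _∷_; _++_; map; length; filter; allFin)
open import Data.List.Properties using (filter-notAll)
open import Data.List.Membership.Propositional using (_∈_; _∉_; find; lose)
open import Data.List.Membership.Propositional.Properties using (∈-filter⁺; ∈-++⁺ˡ; ∈-++⁺ʳ; ∈-map⁺; ∈-map⁻; ∈-allFin)
open import Data.List.Relation.Unary.Any using (Any; here; there; any?)
import Data.List.Relation.Unary.Any as Any
open import Data.List.Relation.Unary.All using (All; []; _∷_)
import Data.List.Relation.Unary.All as All
open import Data.List.Relation.Unary.AllPairs using ([]; _∷_; allPairs?)
open import Data.List.Relation.Unary.Unique.Propositional using (Unique)
import Data.List.Relation.Unary.Unique.Propositional.Properties as Unique
open import Relation.Nullary using (¬_; Dec; yes; no)
open import Relation.Nullary.Decidable using (_×-dec_; ¬?)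
open import Relation.Binary using (DecidableEquality)
open import Relation.Binary.PropositionalEquality
open import Relation.Binary.Construct.Closure.Transitive using (TransClosure; [_]; _∷_)

Sub-≡ : ∀ {A : Set} {P : A → Set} {a b : Sub A P} → Sub.val a ≡ Sub.val b → a ≡ b
Sub-≡ {a = a , _} {b = .a , _} refl = refl

inj₁≢inj₂ : ∀ {A B : Set} {x : A} {y : B} → inj₁ x ≢ inj₂ y
inj₁≢inj₂ ()

inj₂≢inj₁ : ∀ {A B : Set} {x : A} {y : B} → inj₂ y ≢ inj₁ x
inj₂≢inj₁ ()

Unique-head : ∀ {A : Set} {x : A} {xs} → Unique (x ∷ xs) → x ∉ xs
Unique-head (x≢xs ∷ _) x∈xs = All.lookup x≢xs x∈xs refl

∈⇒nonempty : ∀ {A : Set} {x : A} {xs} → x ∈ xs → 0 < length xs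
∈⇒nonempty (here _)  = s≤s z≤n
∈⇒nonempty (there _) = s≤s z≤n

unique-length≤ : ∀ {A : Set} → DecidableEquality A → ∀ {xs ys : List A}
               → Unique xs → All (_∈ ys) xs → length xs ≤ length ys
unique-length≤ _≟_ [] [] = z≤n
unique-length≤ _≟_ {x ∷ xs} {ys} (x≢xs ∷ u) (x∈ys ∷ xs⊆ys) =
  ≤-<-trans (unique-length≤ _≟_ u (inRest x≢xs xs⊆ys))
            (filter-notAll (λ y → ¬? (y ≟ x)) ys (Any.map (λ { refl ne → ne refl }) x∈ys))
  where
  inRest : ∀ {zs} → All (x ≢_) zs → All (_∈ ys) zs → All (_∈ filter (λ y → ¬? (y ≟ x)) ys) zs
  inRest [] [] = []
  inRest (x≢z ∷ ns) (z∈ys ∷ ms) = ∈-filter⁺ (λ y → ¬? (y ≟ x)) z∈ys (λ z≡x → x≢z (sym z≡x)) ∷ inRest ns ms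

restrict : ∀ {A : Set} {P : A → Set} → (∀ a → Dec (P a)) → List A → List (Sub A P)
restrict P? [] = []
restrict P? (x ∷ xs) with P? x
... | yes p = (x , p) ∷ restrict P? xs
... | no _  = restrict P? xs

restrict-complete : ∀ {A : Set} {P : A → Set} (P? : ∀ a → Dec (P a)) {a} .(p : P a) {xs}
                  → a ∈ xs → (a , p) ∈ restrict P? xs
restrict-complete P? p {x ∷ xs} a∈ with P? x
restrict-complete P? p {x ∷ xs} (here refl) | yes _  = here refl
restrict-complete P? p {x ∷ xs} (there a∈) | yes _  = there (restrict-complete P? p a∈)
restrict-complete P? p {x ∷ xs} (here refl) | no ¬p = ⊥-elim-irr (¬p p)
restrict-complete P? p {x ∷ xs} (there a∈) | no _   = restrict-complete P? p a∈

restrict-length≤ : ∀ {A : Set} {P : A → Set} (P? : ∀ a → Dec (P a)) xs → length (restrict P? xs) ≤ length xs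
restrict-length≤ P? [] = z≤n
restrict-length≤ P? (x ∷ xs) with P? x
... | yes _ = s≤s (restrict-length≤ P? xs)
... | no _  = m≤n⇒m≤1+n (restrict-length≤ P? xs)

restrict-shorter : ∀ {A : Set} {P : A → Set} (P? : ∀ a → Dec (P a)) {a xs}
                 → a ∈ xs → ¬ P a → length (restrict P? xs) < length xs
restrict-shorter P? {a} {x ∷ xs} a∈ ¬pa with P? x
restrict-shorter P? {a} {x ∷ xs} (here refl) ¬pa | yes p = ⊥-elim (¬pa p)
restrict-shorter P? {a} {x ∷ xs} (there a∈) ¬pa  | yes p = s≤s (restrict-shorter P? a∈ ¬pa)
restrict-shorter P? {a} {x ∷ xs} a∈ ¬pa          | no _  = s≤s (restrict-length≤ P? xs)

≢? : ∀ {A : Set} → DecidableEquality A → ∀ x a → Dec (a ≢ x)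
≢? _≟_ x a = ¬? (a ≟ x)

exactlyOne-unique : ∀ {A : Set} {P : A → Set} → HasExactly 1 P → ∀ {a b} → P a → P b → a ≡ b
exactlyOne-unique (_ , _ , only) pa pb = trans (only _ pa) (sym (only _ pb))

exactlyTwo-other : ∀ {A : Set} {P : A → Set} → HasExactly 2 P → ∀ {x} → P x
                 → Σ A λ y → P y × y ≢ x × (∀ b → P b → b ≡ x ⊎ b ≡ y)
exactlyTwo-other (a₁ , a₂ , a₁≢a₂ , p₁ , p₂ , only) {x} px with only x px
... | inj₁ refl = a₂ , p₂ , (λ eq → a₁≢a₂ (sym eq)) , only
... | inj₂ refl = a₁ , p₁ , a₁≢a₂ , λ b pb → swap (only b pb)
  where
  swap : ∀ {b} → b ≡ a₁ ⊎ b ≡ a₂ → b ≡ a₂ ⊎ b ≡ a₁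
  swap (inj₁ e) = inj₂ e
  swap (inj₂ e) = inj₁ e

exactly-transport : ∀ {A B : Set} {P : A → Set} {Q : B → Set} n (f : (a : A) → .(P a) → B)
  → (∀ a pa → Q (f a pa)) → (∀ b → Q b → Σ A λ a → Σ (P a) λ pa → f a pa ≡ b)
  → (∀ a a′ pa pa′ → f a pa ≡ f a′ pa′ → a ≡ a′)
  → HasExactly n P → HasExactly n Q
exactly-transport zero f fQ onto inj none b qb with onto b qb
... | a , pa , _ = none a pa
exactly-transport (suc zero) f fQ onto inj (a , pa , only) = f a pa , fQ a pa , λ b qb → image b qb
  where
  image : ∀ b → _ → b ≡ f a pa
  image b qb with onto b qb
  ... | a′ , pa′ , refl with only a′ pa′
  ... | refl = refl
exactly-transport (suc (suc zero)) f fQ onto inj (a₁ , a₂ , a₁≢a₂ , p₁ , p₂ , only) =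
  f a₁ p₁ , f a₂ p₂ , (λ eq → a₁≢a₂ (inj a₁ a₂ p₁ p₂ eq)) , fQ a₁ p₁ , fQ a₂ p₂ , image
  where
  image : ∀ b → _ → b ≡ f a₁ p₁ ⊎ b ≡ f a₂ p₂
  image b qb with onto b qb
  ... | a′ , pa′ , refl with only a′ pa′
  ... | inj₁ refl = inj₁ refl
  ... | inj₂ refl = inj₂ refl
exactly-transport (suc (suc (suc n))) f fQ onto inj ()

exactly-without : ∀ {A : Set} {P : A → Set} {e1 : A} {Q : Sub A (_≢ e1) → Set} n
  → .(∀ {e} → P e → e ≢ e1) → (∀ e .q → P e → Q (e , q)) → (∀ e .q → Q (e , q) → P e)
  → HasExactly n P → HasExactly n Q
exactly-without n P⇒≢e1 P⇒Q Q⇒P =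
  exactly-transport n (λ e pe → e , P⇒≢e1 pe) (λ e pe → P⇒Q e _ pe)
    (λ { (e , q) qe → e , Q⇒P e q qe , refl }) (λ _ _ _ _ eq → cong Sub.val eq)

exactly-≟ : ∀ n {A : Set} {P : A → Set} → HasExactly n P → ∀ {a b} → P a → P b → Dec (a ≡ b)
exactly-≟ zero none pa pb = ⊥-elim (none _ pa)
exactly-≟ (suc zero) one pa pb = yes (exactlyOne-unique one pa pb)
exactly-≟ (suc (suc zero)) (a₁ , a₂ , a₁≢a₂ , _ , _ , only) {a} {b} pa pb with only a pa | only b pb
... | inj₁ refl | inj₁ refl = yes refl
... | inj₁ refl | inj₂ refl = no a₁≢a₂
... | inj₂ refl | inj₁ refl = no (λ eq → a₁≢a₂ (sym eq))
... | inj₂ refl | inj₂ refl = yes refl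
exactly-≟ (suc (suc (suc n))) ()

polarityOf : ∀ {h k} {B : Raw h k} → IsFlow B → Raw.E B → Bool
polarityOf wf = proj₁ (IsFlow.polarity wf)

PolRel-reindex : ∀ {h k h′ k′} {A : Raw h k} {B : Raw h′ k′} κ {a b} → PolRel A κ a b → PolRel B κ a b
PolRel-reindex interaction   r = r
PolRel-reindex cut           r = r
PolRel-reindex weakening     r = tt
PolRel-reindex coweakening   r = tt
PolRel-reindex contraction   r = r
PolRel-reindex cocontraction r = r

interaction≢cut : interaction ≢ cut
interaction≢cut ()

isCut? : (κ : Kind) → Dec (κ ≡ cut)
isCut? interaction   = no λ ()
isCut? cut           = yes refl
isCut? weakening     = no λ ()
isCut? coweakening   = no λ ()
isCut? contraction   = no λ ()
isCut? cocontraction = no λ ()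

isInteraction? : (κ : Kind) → Dec (κ ≡ interaction)
isInteraction? interaction   = yes refl
isInteraction? cut           = no λ ()
isInteraction? weakening     = no λ ()
isInteraction? coweakening   = no λ ()
isInteraction? contraction   = no λ ()
isInteraction? cocontraction = no λ ()

reDir : ∀ {h k h′ k′} {A : Raw h k} {B : Raw h′ k′} → Dir A → Dir B
reDir down = down
reDir up   = up

changes : ∀ {h k} {B : Raw h k} → Dir B → Dir B → Bool
changes down down = false
changes up   up   = false
changes down up   = true
changes up   down = true

-- a path changes direction overall iff it does so an odd number of times
changes-refl : ∀ {h k} {B : Raw h k} (d : Dir B) → changes d d ≡ false
changes-refl down = refl
changes-refl up   = refl

changes-trans : ∀ {h k} {B : Raw h k} (d d₁ d₂ : Dir B) → changes d₁ d₂ xor changes d d₁ ≡ changes d d₂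
changes-trans down down down = refl
changes-trans down down up   = refl
changes-trans down up   down = refl
changes-trans down up   up   = refl
changes-trans up   down down = refl
changes-trans up   down up   = refl
changes-trans up   up   down = refl
changes-trans up   up   up   = refl

Dir-≟ : ∀ {h k} {B : Raw h k} → DecidableEquality (Dir B)
Dir-≟ down down = yes refl
Dir-≟ up   up   = yes refl
Dir-≟ down up   = no λ ()
Dir-≟ up   down = no λ ()

∃Dir? : ∀ {h k} {B : Raw h k} (P : Dir B → Set) → (∀ d → Dec (P d)) → Dec (Σ (Dir B) P)
∃Dir? P P? with P? down | P? up
... | yes p | _     = yes (down , p)
... | _     | yes p = yes (up , p)
... | no ¬p | no ¬q = no λ { (down , p) → ¬p p ; (up , p) → ¬q p }

module FlowFacts {h k : ℕ} (B : Raw h k) (wf : IsFlow B) where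
  open Raw B
  open IsFlow wf

  pol : E → Bool
  pol = polarityOf wf

  pol-ok : Polarised B pol
  pol-ok = proj₂ polarity

  upperOf : ∀ {v κ} → kind v ≡ κ → HasExactly (upArity κ) (λ e → bot e ≡ inj₁ v)
  upperOf {v} refl = upperArity v

  lowerOf : ∀ {v κ} → kind v ≡ κ → HasExactly (lowArity κ) (λ e → top e ≡ inj₁ v)
  lowerOf {v} refl = lowerArity v

  firstE : ∀ {x d y d′ es} → AIPath B x d y d′ es → E
  firstE ([_] {e = e} _)       = e
  firstE (_∷⟨_⟩_ {e = e} _ _ _) = e

  lastE : ∀ {x d y d′ es} → AIPath B x d y d′ es → E
  lastE ([_] {e = e} _) = e
  lastE (_ ∷⟨ _ ⟩ q)    = lastE q

  firstTrav : ∀ {x d y d′ es} (p : AIPath B x d y d′ es) → ∃ λ z → Trav B (firstE p) d x z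
  firstTrav [ t ]        = _ , t
  firstTrav (t ∷⟨ _ ⟩ _) = _ , t

  lastTrav : ∀ {x d y d′ es} (p : AIPath B x d y d′ es) → ∃ λ z → Trav B (lastE p) d′ z y
  lastTrav [ t ]        = _ , t
  lastTrav (_ ∷⟨ _ ⟩ q) = lastTrav q

  first∈ : ∀ {x d y d′ es} (p : AIPath B x d y d′ es) → firstE p ∈ es
  first∈ [ _ ]        = here refl
  first∈ (_ ∷⟨ _ ⟩ _) = here refl

  last∈ : ∀ {x d y d′ es} (p : AIPath B x d y d′ es) → lastE p ∈ es
  last∈ [ _ ]        = here refl
  last∈ (_ ∷⟨ _ ⟩ q) = there (last∈ q)

  trav-ends : ∀ {e x y} {d : Dir B} → Trav B e d x y → (∃ λ a → top e ≡ inj₁ a) × (∃ λ b → bot e ≡ inj₁ b)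
  trav-ends {d = down} (t , b) = (_ , t) , (_ , b)
  trav-ends {d = up}   (b , t) = (_ , t) , (_ , b)

  trav-source : ∀ {e x y} {d : Dir B} → Trav B e d x y → Incident B x e
  trav-source {d = down} (t , _) = inj₁ t
  trav-source {d = up}   (b , _) = inj₂ b

  trav-target : ∀ {e x y} {d : Dir B} → Trav B e d x y → Incident B y e
  trav-target {d = down} (_ , b) = inj₂ b
  trav-target {d = up}   (_ , t) = inj₁ t

  trav-incident : ∀ {e x y v} {d : Dir B} → Trav B e d x y → Incident B v e → v ≡ x ⊎ v ≡ y
  trav-incident {d = down} (t , _) (inj₁ t′) = inj₁ (inj₁-injective (trans (sym t′) t))
  trav-incident {d = down} (_ , b) (inj₂ b′) = inj₂ (inj₁-injective (trans (sym b′) b))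
  trav-incident {d = up}   (_ , t) (inj₁ t′) = inj₂ (inj₁-injective (trans (sym t′) t))
  trav-incident {d = up}   (b , _) (inj₂ b′) = inj₁ (inj₁-injective (trans (sym b′) b))

  path-edge-ends : ∀ {x d y d′ es} → AIPath B x d y d′ es → ∀ {e} → e ∈ es
                 → (∃ λ a → top e ≡ inj₁ a) × (∃ λ b → bot e ≡ inj₁ b)
  path-edge-ends [ t ]        (here refl) = trav-ends t
  path-edge-ends [ t ]        (there ())
  path-edge-ends (t ∷⟨ _ ⟩ _) (here refl) = trav-ends t
  path-edge-ends (_ ∷⟨ _ ⟩ q) (there m)   = path-edge-ends q m

  -- an ai-cycle leaves its start along a different edge than it returns:
  -- a single edge from a vertex to itself would be a cycle in the DAG
  cycle-ends-differ : ∀ {x d d′ es} (p : AIPath B x d x d′ es) → Unique es → firstE p ≢ lastE p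
  cycle-ends-differ {d = down} [ (t , b) ] _ _ = acyclic _ [ (_ , t , b) ]
  cycle-ends-differ {d = up}   [ (b , t) ] _ _ = acyclic _ [ (_ , t , b) ]
  cycle-ends-differ (t ∷⟨ _ ⟩ q) u first≡last = Unique-head u (subst (_∈ _) (sym first≡last) (last∈ q))

  -- Polarity along ai-paths: it flips exactly when the direction changes

  -- the only vertices with an upper and a lower edge are (co)contractions,
  -- which give all their edges the same polarity
  straight : ∀ y e e′ → bot e ≡ inj₁ y → top e′ ≡ inj₁ y → e ≢ e′ → pol e ≡ pol e′
  straight y e e′ b t e≢e′ = through (kind y) refl (pol-ok y e e′ (inj₂ b) (inj₁ t) e≢e′)
    where
    through : ∀ κ → kind y ≡ κ → PolRel B κ (pol e) (pol e′) → pol e ≡ pol e′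
    through interaction   hy _ = ⊥-elim (upperOf hy e b)
    through cut           hy _ = ⊥-elim (lowerOf hy e′ t)
    through weakening     hy _ = ⊥-elim (upperOf hy e b)
    through coweakening   hy _ = ⊥-elim (lowerOf hy e′ t)
    through contraction   hy r = r
    through cocontraction hy r = r

  polarity-turn : ∀ {x y z e e′} {d d₁ : Dir B} → Trav B e d x y → Turn B d y d₁ → Trav B e′ d₁ y z
                → e ≢ e′ → pol e′ ≡ changes d d₁ xor pol e
  polarity-turn {d = down} {down} (_ , b) _ (t′ , _) e≢e′ = sym (straight _ _ _ b t′ e≢e′)
  polarity-turn {d = up}   {up}   (_ , t) _ (b′ , _) e≢e′ = straight _ _ _ b′ t (λ eq → e≢e′ (sym eq))
  polarity-turn {y = y} {e = e} {e′} {d = down} {up} (_ , b) isCut (b′ , _) e≢e′ =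
    ¬-not (λ eq → subst (λ κ → PolRel B κ (pol e) (pol e′)) isCut (pol-ok y e e′ (inj₂ b) (inj₂ b′) e≢e′) (sym eq))
  polarity-turn {y = y} {e = e} {e′} {d = up} {down} (_ , t) isInt (t′ , _) e≢e′ =
    ¬-not (λ eq → subst (λ κ → PolRel B κ (pol e) (pol e′)) isInt (pol-ok y e e′ (inj₁ t) (inj₁ t′) e≢e′) (sym eq))

  polarity-path : ∀ {x d y d′ es} (p : AIPath B x d y d′ es) → Unique es
                → pol (lastE p) ≡ changes d d′ xor pol (firstE p)
  polarity-path {d = d} p@([ t ]) _ = cong (_xor pol (firstE p)) (sym (changes-refl d))
  polarity-path {d = d} {d′ = d′} (_∷⟨_⟩_ {e = e} {d₁ = d₁} t tn q) u@(_ ∷ u′) = begin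
    pol (lastE q)                               ≡⟨ polarity-path q u′ ⟩
    changes d₁ d′ xor pol (firstE q)            ≡⟨ cong (changes d₁ d′ xor_) (polarity-turn t tn (proj₂ (firstTrav q)) e≢next) ⟩
    changes d₁ d′ xor (changes d d₁ xor pol e)  ≡⟨ sym (xor-assoc (changes d₁ d′) _ _) ⟩
    (changes d₁ d′ xor changes d d₁) xor pol e  ≡⟨ cong (_xor pol e) (changes-trans d d₁ d′) ⟩
    changes d d′ xor pol e                      ∎
    where
    open ≡-Reasoning
    e≢next : e ≢ firstE q
    e≢next eq = Unique-head u (subst (_∈ _) (sym eq) (first∈ q))

  -- an ai-cycle that changes direction overall reverses polarity, so it
  -- cannot start at a (co)contraction, whose edges share one polarity
  no-reversing-cycle-at : (c : AICycle B) → let s = AICycle.start c in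
    (kind s ≡ contraction ⊎ kind s ≡ cocontraction) → changes (AICycle.d₁ c) (AICycle.d₂ c) ≡ true → ⊥
  no-reversing-cycle-at c s-kind reverses =
    not-¬ (sym same) (trans (polarity-path p u) (cong (_xor pol f) reverses))
    where
    open AICycle c renaming (path to p; distinct to u)
    f l : E
    f = firstE p
    l = lastE p
    rel : PolRel B (kind start) (pol f) (pol l)
    rel = pol-ok start f l (trav-source (proj₂ (firstTrav p))) (trav-target (proj₂ (lastTrav p)))
                 (cycle-ends-differ p u)
    same : pol f ≡ pol l
    same = sharing s-kind
      where
      sharing : (kind start ≡ contraction ⊎ kind start ≡ cocontraction) → pol f ≡ pol l
      sharing (inj₁ hs) = subst (λ κ → PolRel B κ (pol f) (pol l)) hs rel
      sharing (inj₂ hs) = subst (λ κ → PolRel B κ (pol f) (pol l)) hs rel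

  Impassable : V → Set
  Impassable y = ∀ {x z e e′} {d d₁ : Dir B} → Trav B e d x y → Turn B d y d₁ → Trav B e′ d₁ y z → ⊥

  impassable-at-end : ∀ {v} → Impassable v → ∀ {x d y d′ es} (p : AIPath B x d y d′ es) → ∀ {e}
    → e ∈ es → Incident B v e → (x ≡ v × firstE p ≡ e) ⊎ (y ≡ v × lastE p ≡ e)
  impassable-at-end imp [ t ] (here refl) i with trav-incident t i
  ... | inj₁ refl = inj₁ (refl , refl)
  ... | inj₂ refl = inj₂ (refl , refl)
  impassable-at-end imp [ t ] (there ()) i
  impassable-at-end imp (t ∷⟨ tn ⟩ q) (here refl) i with trav-incident t i
  ... | inj₁ refl = inj₁ (refl , refl)
  ... | inj₂ refl = ⊥-elim (imp t tn (proj₂ (firstTrav q)))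
  impassable-at-end imp (t ∷⟨ tn ⟩ q) (there m) i with impassable-at-end imp q m i
  ... | inj₁ (refl , _) = ⊥-elim (imp t tn (proj₂ (firstTrav q)))
  ... | inj₂ r          = inj₂ r

  -- hence no ai-cycle uses an edge at an impassable vertex with a single
  -- incident edge: the cycle would leave and re-enter it along that edge
  lonely-off-cycles : ∀ {v} → Impassable v → (∀ {e e′} → Incident B v e → Incident B v e′ → e ≡ e′)
    → (c : AICycle B) → ∀ {e} → e ∈ AICycle.edges c → Incident B v e → ⊥
  lonely-off-cycles {v} imp lonely c m i =
    cycle-ends-differ p u (lonely (at-v (trav-source (proj₂ (firstTrav p)))) (at-v (trav-target (proj₂ (lastTrav p)))))
    where
    open AICycle c renaming (path to p; distinct to u)
    start≡v : start ≡ v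
    start≡v with impassable-at-end imp p m i
    ... | inj₁ (eq , _) = eq
    ... | inj₂ (eq , _) = eq
    at-v : ∀ {e} → Incident B start e → Incident B v e
    at-v = subst (λ s → Incident B s _) start≡v

  -- a weakening has a single (lower) edge, and a path could only pass
  -- through it by entering from below and turning, which needs an interaction
  weakening-off-cycles : ∀ {v} → kind v ≡ weakening → (c : AICycle B) → ∀ {e}
                       → e ∈ AICycle.edges c → top e ≡ inj₁ v → ⊥
  weakening-off-cycles {v} hv c m t = lonely-off-cycles impassable lonely c m (inj₁ t)
    where
    impassable : Impassable v
    impassable {d = down}        (_ , b) _  _       = upperOf hv _ b
    impassable {d = up} {down}   _       tn _       = interaction≢weakening (trans (sym tn) hv)
      where interaction≢weakening : interaction ≢ weakening
            interaction≢weakening ()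
    impassable {d = up} {up}     _       _  (b , _) = upperOf hv _ b
    lonely : ∀ {e e′} → Incident B v e → Incident B v e′ → e ≡ e′
    lonely (inj₁ t₁) (inj₁ t₂) = exactlyOne-unique (lowerOf hv) t₁ t₂
    lonely (inj₂ b)  _         = ⊥-elim (upperOf hv _ b)
    lonely _         (inj₂ b)  = ⊥-elim (upperOf hv _ b)

  coweakening-off-cycles : ∀ {v} → kind v ≡ coweakening → (c : AICycle B) → ∀ {e}
                         → e ∈ AICycle.edges c → bot e ≡ inj₁ v → ⊥
  coweakening-off-cycles {v} hv c m b = lonely-off-cycles impassable lonely c m (inj₂ b)
    where
    impassable : Impassable v
    impassable {d = up}            (_ , t) _  _       = lowerOf hv _ t
    impassable {d = down} {up}     _       tn _       = cut≢coweakening (trans (sym tn) hv)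
      where cut≢coweakening : cut ≢ coweakening
            cut≢coweakening ()
    impassable {d = down} {down}   _       _  (t , _) = lowerOf hv _ t
    lonely : ∀ {e e′} → Incident B v e → Incident B v e′ → e ≡ e′
    lonely (inj₂ b₁) (inj₂ b₂) = exactlyOne-unique (upperOf hv) b₁ b₂
    lonely (inj₁ t)  _         = ⊥-elim (lowerOf hv _ t)
    lonely _         (inj₁ t)  = ⊥-elim (lowerOf hv _ t)

  -- edges are compared through their upper ends: a boundary label determines
  -- its edge, and among the lower edges of a vertex equality is decidable
  _≟E_ : DecidableEquality E
  e ≟E e′ = compare (top e) refl (top e′) refl
    where
    compare : (x : V ⊎ Fin h) → top e ≡ x → (y : V ⊎ Fin h) → top e′ ≡ y → Dec (e ≡ e′)
    compare (inj₂ i) t (inj₂ j) t′ with i Fin.≟ j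
    ... | yes refl = yes (trans (inE-unique i e t) (sym (inE-unique i e′ t′)))
    ... | no i≢j   = no (λ eq → i≢j (inj₂-injective (trans (sym t) (trans (cong top eq) t′))))
    compare (inj₁ v) t (inj₁ w) t′ with v ≟V w
    ... | yes refl = exactly-≟ _ (lowerArity v) t t′
    ... | no v≢w   = no (λ eq → v≢w (inj₁-injective (trans (sym t) (trans (cong top eq) t′))))
    compare (inj₁ v) t (inj₂ j) t′ = no (λ eq → inj₁≢inj₂ (trans (sym t) (trans (cong top eq) t′)))
    compare (inj₂ i) t (inj₁ w) t′ = no (λ eq → inj₂≢inj₁ (trans (sym t) (trans (cong top eq) t′)))

  Turn? : ∀ (d : Dir B) y d₁ → Dec (Turn B d y d₁)
  Turn? down y down = yes tt
  Turn? up   y up   = yes tt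
  Turn? down y up   = isCut? (kind y)
  Turn? up   y down = isInteraction? (kind y)

  Trav? : ∀ e (d : Dir B) x y → Dec (Trav B e d x y)
  Trav? e down x y = ≡-dec _≟V_ Fin._≟_ (top e) (inj₁ x) ×-dec ≡-dec _≟V_ Fin._≟_ (bot e) (inj₁ y)
  Trav? e up   x y = ≡-dec _≟V_ Fin._≟_ (bot e) (inj₁ x) ×-dec ≡-dec _≟V_ Fin._≟_ (top e) (inj₁ y)

  trav-functional : ∀ {e x y y′} (d : Dir B) → Trav B e d x y → Trav B e d x y′ → y ≡ y′
  trav-functional down (_ , b) (_ , b′) = inj₁-injective (trans (sym b) b′)
  trav-functional up   (_ , t) (_ , t′) = inj₁-injective (trans (sym t) t′)

  targets : ∀ e (d : Dir B) x → Dec (∃ λ z → Trav B e d x z)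
  targets e down x with bot e | ≡-dec _≟V_ Fin._≟_ (top e) (inj₁ x)
  ... | inj₂ _ | _     = no λ { (_ , _ , ()) }
  ... | inj₁ z | yes t = yes (z , t , refl)
  ... | inj₁ z | no ¬t = no λ { (_ , t , _) → ¬t t }
  targets e up x with top e | ≡-dec _≟V_ Fin._≟_ (bot e) (inj₁ x)
  ... | inj₂ _ | _     = no λ { (_ , _ , ()) }
  ... | inj₁ z | yes b = yes (z , b , refl)
  ... | inj₁ z | no ¬b = no λ { (_ , b , _) → ¬b b }

  AIPath? : ∀ es x (d : Dir B) y d′ → Dec (AIPath B x d y d′ es)
  AIPath? [] x d y d′ = no λ ()
  AIPath? (e ∷ []) x d y d′ with Dir-≟ d d′ | Trav? e d x y
  ... | yes refl | yes t  = yes [ t ]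
  ... | no d≢d′  | _      = no λ { [ _ ] → d≢d′ refl }
  ... | yes refl | no ¬t  = no λ { [ t ] → ¬t t }
  AIPath? (e ∷ e′ ∷ es) x d y d′ = cons? e x d (λ z d₁ → AIPath? (e′ ∷ es) z d₁ y d′)
    where
    cons? : ∀ e x (d : Dir B) → (∀ z d₁ → Dec (AIPath B z d₁ y d′ (e′ ∷ es)))
          → Dec (AIPath B x d y d′ (e ∷ e′ ∷ es))
    cons? e x d rest with targets e d x
    ... | no ¬t = no λ { (t ∷⟨ _ ⟩ _) → ¬t (_ , t) }
    ... | yes (z , t) with ∃Dir? _ (λ d₁ → Turn? d z d₁ ×-dec rest z d₁)
    ...   | yes (d₁ , tn , q) = yes (t ∷⟨ tn ⟩ q)
    ...   | no ¬rest = no λ { (t′ ∷⟨ tn ⟩ q) → ¬rest (_ , subst (λ z′ → Turn B d z′ _ × AIPath B z′ _ y d′ (e′ ∷ es))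
                                                              (trav-functional d t′ t) (tn , q)) }

  search : ∀ (ys : List E) n (P : List E → Set) → (∀ L → Dec (P L))
         → Dec (Σ (List E) λ L → length L ≤ n × All (_∈ ys) L × P L)
  search ys zero P P? with P? []
  ... | yes p = yes ([] , z≤n , [] , p)
  ... | no ¬p = no λ { ([] , _ , _ , p) → ¬p p ; (_ ∷ _ , () , _) }
  search ys (suc n) P P? with P? [] | any? (λ e → search ys n (λ L → P (e ∷ L)) (λ L → P? (e ∷ L))) ys
  ... | yes p | _ = yes ([] , z≤n , [] , p)
  ... | no _  | yes found with find found
  ...   | e , e∈ys , (L , ≤n , L⊆ys , p) = yes (e ∷ L , s≤s ≤n , e∈ys ∷ L⊆ys , p)
  search ys (suc n) P P? | no ¬p | no ¬found =
    no λ { ([] , _ , _ , p) → ¬p p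
         ; (e ∷ L , s≤s ≤n , e∈ys ∷ L⊆ys , p) → ¬found (lose e∈ys (L , ≤n , L⊆ys , p)) }

  IsCycleList : List E → Set
  IsCycleList L = Unique L × Any (λ x → Σ (Dir B) λ d₁ → Σ (Dir B) λ d₂ → AIPath B x d₁ x d₂ L) (proj₁ finiteV)

  isCycleList? : ∀ L → Dec (IsCycleList L)
  isCycleList? L = allPairs? (λ x y → ¬? (x ≟E y)) L
    ×-dec any? (λ x → ∃Dir? _ (λ d₁ → ∃Dir? _ (λ d₂ → AIPath? L x d₁ x d₂))) (proj₁ finiteV)

  allEdges : ∀ L → All (_∈ proj₁ finiteE) L
  allEdges []      = []
  allEdges (e ∷ L) = proj₂ finiteE e ∷ allEdges L

  -- an ai-cycle uses each edge at most once, so its edge list is among the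
  -- finitely many lists of at most |E| edges
  AICycle? : Dec (AICycle B)
  AICycle? with search (proj₁ finiteE) (length (proj₁ finiteE)) IsCycleList isCycleList?
  ... | yes (L , _ , _ , u , cyc) with find cyc
  ...   | x , _ , (d₁ , d₂ , p) = yes record { start = x ; d₁ = d₁ ; d₂ = d₂ ; edges = L ; path = p ; distinct = u }
  AICycle? | no none = no λ c → let open AICycle c in
    none (edges , unique-length≤ _≟E_ distinct (allEdges edges) , allEdges edges , distinct
         , lose (proj₂ finiteV start) (d₁ , d₂ , path))

NewEnd : Kind → Set
NewEnd κ = κ ≡ weakening ⊎ κ ≡ coweakening

record Reflection {h k h′ k′} (A : Raw h′ k′) (B : Raw h k) : Set where
  private
    module A = Raw A
    module B = Raw B
  field
    vmap           : A.V → B.V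
    emap           : A.E → B.E
    emap-injective : ∀ {e e′} → emap e ≡ emap e′ → e ≡ e′
    top-reflect    : ∀ {e v} → A.top e ≡ inj₁ v → B.top (emap e) ≡ inj₁ (vmap v)
    bot-reflect    : ∀ {e v} → A.bot e ≡ inj₁ v → B.bot (emap e) ≡ inj₁ (vmap v)
    kind-reflect   : ∀ v → A.kind v ≡ B.kind (vmap v) ⊎ NewEnd (A.kind v)

module Reflect {h k h′ k′} {A : Raw h′ k′} {B : Raw h k} (r : Reflection A B) where
  open Reflection r
  private
    module A = Raw A
    module B = Raw B

  trav : ∀ {e x y} {d : Dir A} → Trav A e d x y → Trav B (emap e) (reDir d) (vmap x) (vmap y)
  trav {d = down} (t , b) = top-reflect t , bot-reflect b
  trav {d = up}   (b , t) = bot-reflect b , top-reflect t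

  -- turning vertices are interactions and cuts, which are never new ends
  turn : ∀ {y} {d d₁ : Dir A} → Turn A d y d₁ → Turn B (reDir d) (vmap y) (reDir d₁)
  turn {d = down} {down} _ = tt
  turn {d = up}   {up}   _ = tt
  turn {y} {d = down} {up} isCut with kind-reflect y
  ... | inj₁ same             = trans (sym same) isCut
  ... | inj₂ (inj₁ isWeak)    = ⊥-elim (cut≢new (trans (sym isCut) isWeak))
    where cut≢new : cut ≢ weakening
          cut≢new ()
  ... | inj₂ (inj₂ isCoweak)  = ⊥-elim (cut≢new (trans (sym isCut) isCoweak))
    where cut≢new : cut ≢ coweakening
          cut≢new ()
  turn {y} {d = up} {down} isInt with kind-reflect y
  ... | inj₁ same             = trans (sym same) isInt
  ... | inj₂ (inj₁ isWeak)    = ⊥-elim (int≢new (trans (sym isInt) isWeak))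
    where int≢new : interaction ≢ weakening
          int≢new ()
  ... | inj₂ (inj₂ isCoweak)  = ⊥-elim (int≢new (trans (sym isInt) isCoweak))
    where int≢new : interaction ≢ coweakening
          int≢new ()

  ai-path : ∀ {x d y d′ es} → AIPath A x d y d′ es → AIPath B (vmap x) (reDir d) (vmap y) (reDir d′) (map emap es)
  ai-path [ t ]        = [ trav t ]
  ai-path (t ∷⟨ tn ⟩ q) = trav t ∷⟨ turn tn ⟩ ai-path q

  ai-cycle : AICycle A → AICycle B
  ai-cycle c = record
    { start = vmap start ; d₁ = reDir d₁ ; d₂ = reDir d₂ ; edges = map emap edges
    ; path = ai-path (AICycle.path c) ; distinct = Unique.map⁺ emap-injective distinct }
    where open AICycle c using (start; d₁; d₂; edges; distinct)

  acyclic : (∀ v → ¬ TransClosure (Step B) v v) → ∀ v → ¬ TransClosure (Step A) v v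
  acyclic acyclicB v loop = acyclicB (vmap v) (∘tc loop)
    where
    ∘tc : ∀ {x y} → TransClosure (Step A) x y → TransClosure (Step B) (vmap x) (vmap y)
    ∘tc [ (e , s) ]     = [ (emap e , trav {d = down} s) ]
    ∘tc ((e , s) ∷ ss) = (emap e , trav {d = down} s) ∷ ∘tc ss

  polarised : ∀ {pol} → Polarised B pol → Polarised A (λ e → pol (emap e))
  polarised {pol} ok v e e′ i i′ e≢e′ with kind-reflect v
  ... | inj₁ same = subst (λ κ → PolRel A κ (pol (emap e)) (pol (emap e′))) (sym same)
                      (PolRel-reindex {A = B} {B = A} (B.kind (vmap v))
                        (ok (vmap v) (emap e) (emap e′) (incident i) (incident i′) (λ eq → e≢e′ (emap-injective eq))))
    where
    incident : ∀ {e} → Incident A v e → Incident B (vmap v) (emap e)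
    incident (inj₁ t) = inj₁ (top-reflect t)
    incident (inj₂ b) = inj₂ (bot-reflect b)
  ... | inj₂ (inj₁ isWeak)   = subst (λ κ → PolRel A κ (pol (emap e)) (pol (emap e′))) (sym isWeak) tt
  ... | inj₂ (inj₂ isCoweak) = subst (λ κ → PolRel A κ (pol (emap e)) (pol (emap e′))) (sym isCoweak) tt

-- The simple edge 1 chosen on a cycle, with its neighbourhood: edge 2 is
-- the other lower edge of the interaction u, edge 3 the other upper edge of
-- the cut w.

record SimpleEdgeData {h k : ℕ} (B : Raw h k) : Set where
  open Raw B
  field
    u w      : V
    e1 e2 e3 : E
    hu       : kind u ≡ interaction
    hw       : kind w ≡ cut
    t1       : top e1 ≡ inj₁ u
    b1       : bot e1 ≡ inj₁ w
    t2       : top e2 ≡ inj₁ u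
    e2≢e1    : e2 ≢ e1
    lower-u  : ∀ e → top e ≡ inj₁ u → e ≡ e1 ⊎ e ≡ e2
    b3       : bot e3 ≡ inj₁ w
    e3≢e1    : e3 ≢ e1
    upper-w  : ∀ e → bot e ≡ inj₁ w → e ≡ e1 ⊎ e ≡ e3

  u≢w : u ≢ w
  u≢w u≡w = interaction≢cut (trans (sym hu) (trans (cong kind u≡w) hw))

  boundary≢e1 : ∀ {e j} → bot e ≡ inj₂ j → e ≢ e1
  boundary≢e1 b e≡e1 = inj₂≢inj₁ (trans (sym b) (trans (cong bot e≡e1) b1))

simpleEdgeData : ∀ {h k} (B : Raw h k) → IsFlow B → ∀ {e} → SimpleEdge B e
               → Σ (SimpleEdgeData B) λ sd → SimpleEdgeData.e1 sd ≡ e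
simpleEdgeData B wf {e1} (u , w , t1 , hu , b1 , hw)
  with exactlyTwo-other (lowerOf hu) t1 | exactlyTwo-other (upperOf hw) b1
  where open FlowFacts B wf
... | e2 , t2 , e2≢e1 , lower-u | e3 , b3 , e3≢e1 , upper-w =
  record { u = u ; w = w ; e1 = e1 ; e2 = e2 ; e3 = e3 ; hu = hu ; hw = hw ; t1 = t1 ; b1 = b1 ; t2 = t2
         ; e2≢e1 = e2≢e1 ; lower-u = lower-u ; b3 = b3 ; e3≢e1 = e3≢e1 ; upper-w = upper-w } , refl

module WeakenedCopy {h k : ℕ} (B : Raw h k) (wf : IsFlow B) (sd : SimpleEdgeData B) where
  open Raw B
  open IsFlow wf
  open SimpleEdgeData sd
  open Weakened B wf u w e1 hw t1
  private
    module F = FlowFacts B wf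

  B′ : Raw h (suc k)
  B′ = flow

  kind′-cases : ∀ v .(p : v ≢ w) → (v ≡ u × kind′ (v , p) ≡ weakening) ⊎ (v ≢ u × kind′ (v , p) ≡ kind v)
  kind′-cases v p with v ≟V u
  ... | yes v≡u = inj₁ (v≡u , refl)
  ... | no v≢u  = inj₂ (v≢u , refl)

  -- ends of the edges of B′ in terms of B (⁻: from B′ to B, ⁺: back)
  lift-vertex⁻ : ∀ x p v .pv → lift x p ≡ inj₁ (v , pv) → x ≡ inj₁ v
  lift-vertex⁻ (inj₁ _) p v pv eq = cong inj₁ (cong Sub.val (inj₁-injective eq))

  lift-vertex⁺ : ∀ x p v .pv → x ≡ inj₁ v → lift x p ≡ inj₁ (v , pv)
  lift-vertex⁺ .(inj₁ v) p v pv refl = refl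

  lift-boundary⁻ : ∀ x p i → lift x p ≡ inj₂ i → x ≡ inj₂ i
  lift-boundary⁻ (inj₂ _) p i eq = cong inj₂ (inj₂-injective eq)

  lift-boundary⁺ : ∀ x p i → x ≡ inj₂ i → lift x p ≡ inj₂ i
  lift-boundary⁺ .(inj₂ i) p i refl = refl

  top′-vertex⁻ : ∀ e .(q : e ≢ e1) v .(p : v ≢ w) → top′ (e , q) ≡ inj₁ (v , p) → top e ≡ inj₁ v
  top′-vertex⁻ e q v p = lift-vertex⁻ (top e) _ v p

  top′-vertex⁺ : ∀ e .(q : e ≢ e1) v .(p : v ≢ w) → top e ≡ inj₁ v → top′ (e , q) ≡ inj₁ (v , p)
  top′-vertex⁺ e q v p = lift-vertex⁺ (top e) _ v p

  bot′-vertex⁻ : ∀ e .(q : e ≢ e1) v .(p : v ≢ w) → bot′ (e , q) ≡ inj₁ (v , p) → bot e ≡ inj₁ v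
  bot′-vertex⁻ e q v p b with bot e
  ... | inj₁ v₀ with v₀ ≟V w
  ...   | no _ = cong inj₁ (cong Sub.val (inj₁-injective b))

  bot′-vertex⁺ : ∀ e .(q : e ≢ e1) v .(p : v ≢ w) → bot e ≡ inj₁ v → bot′ (e , q) ≡ inj₁ (v , p)
  bot′-vertex⁺ e q v p b with bot e | b
  ... | .(inj₁ v) | refl with v ≟V w
  ...   | yes v≡w = ⊥-elim-irr (p v≡w)
  ...   | no _    = refl

  bot′-new⁻ : ∀ e .(q : e ≢ e1) → bot′ (e , q) ≡ inj₂ zero → bot e ≡ inj₁ w
  bot′-new⁻ e q b with bot e
  ... | inj₁ v₀ with v₀ ≟V w
  ...   | yes v₀≡w = cong inj₁ v₀≡w

  bot′-new⁺ : ∀ e .(q : e ≢ e1) → bot e ≡ inj₁ w → bot′ (e , q) ≡ inj₂ zero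
  bot′-new⁺ e q b with bot e | b
  ... | .(inj₁ w) | refl with w ≟V w
  ...   | yes _   = refl
  ...   | no w≢w  = ⊥-elim (w≢w refl)

  bot′-old⁻ : ∀ e .(q : e ≢ e1) j → bot′ (e , q) ≡ inj₂ (suc j) → bot e ≡ inj₂ j
  bot′-old⁻ e q j b with bot e
  ... | inj₂ _ = cong inj₂ (Fin.suc-injective (inj₂-injective b))
  ... | inj₁ v₀ with v₀ ≟V w
  ...   | yes _ = ⊥-elim (zero≢suc (inj₂-injective b))
    where zero≢suc : ∀ {n} {i : Fin n} → Fin.zero ≢ suc i
          zero≢suc ()

  bot′-old⁺ : ∀ e .(q : e ≢ e1) j → bot e ≡ inj₂ j → bot′ (e , q) ≡ inj₂ (suc j)
  bot′-old⁺ e q j b with bot e | b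
  ... | .(inj₂ j) | refl = refl

  reflection : Reflection B′ B
  reflection = record
    { vmap = Sub.val ; emap = Sub.val ; emap-injective = Sub-≡
    ; top-reflect = λ { {e , q} {v , p} → top′-vertex⁻ e q v p }
    ; bot-reflect = λ { {e , q} {v , p} → bot′-vertex⁻ e q v p }
    ; kind-reflect = kind-reflect }
    where
    kind-reflect : ∀ v → kind′ v ≡ kind (Sub.val v) ⊎ NewEnd (kind′ v)
    kind-reflect (v , p) with kind′-cases v p
    ... | inj₁ (_ , weak) = inj₂ (inj₁ weak)
    ... | inj₂ (_ , same) = inj₁ same
  private
    module R = Reflect reflection

  upper′ : ∀ v′ → HasExactly (upArity (kind′ v′)) (λ e → bot′ e ≡ inj₁ v′)
  upper′ (v , p) with kind′-cases v p
  ... | inj₁ (refl , weak) = subst (λ κ → HasExactly (upArity κ) (λ e → bot′ e ≡ inj₁ (v , p))) (sym weak)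
          (λ { (e , q) b → interNoUpper B wf u hu e (bot′-vertex⁻ e q u p b) })
  ... | inj₂ (v≢u , same) = subst (λ κ → HasExactly (upArity κ) (λ e → bot′ e ≡ inj₁ (v , p))) (sym same)
          (exactly-without (upArity (kind v)) (λ b e≡e1 → p (inj₁-injective (trans (sym b) (trans (cong bot e≡e1) b1))))
             (λ e q b → bot′-vertex⁺ e q v p b) (λ e q b → bot′-vertex⁻ e q v p b) (upperArity v))

  lower′ : ∀ v′ → HasExactly (lowArity (kind′ v′)) (λ e → top′ e ≡ inj₁ v′)
  lower′ (v , p) with kind′-cases v p
  ... | inj₁ (refl , weak) = subst (λ κ → HasExactly (lowArity κ) (λ e → top′ e ≡ inj₁ (v , p))) (sym weak)
          ((e2 , e2≢e1) , top′-vertex⁺ e2 e2≢e1 u p t2 , λ { (e , q) t → only-e2 e q (lower-u e (top′-vertex⁻ e q u p t)) })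
    where
    only-e2 : ∀ e .(q : e ≢ e1) → e ≡ e1 ⊎ e ≡ e2 → (e , q) ≡ (e2 , e2≢e1)
    only-e2 e q (inj₁ e≡e1) = ⊥-elim-irr (q e≡e1)
    only-e2 e q (inj₂ e≡e2) = Sub-≡ e≡e2
  ... | inj₂ (v≢u , same) = subst (λ κ → HasExactly (lowArity κ) (λ e → top′ e ≡ inj₁ (v , p))) (sym same)
          (exactly-without (lowArity (kind v)) (λ t e≡e1 → v≢u (inj₁-injective (trans (sym t) (trans (cong top e≡e1) t1))))
             (λ e q t → top′-vertex⁺ e q v p t) (λ e q t → top′-vertex⁻ e q v p t) (lowerArity v))

  lower-labels′ : ∀ j → HasExactly 1 (λ e → bot′ e ≡ inj₂ j)
  lower-labels′ zero = (e3 , e3≢e1) , bot′-new⁺ e3 e3≢e1 b3 , λ { (e , q) b → only-e3 e q (upper-w e (bot′-new⁻ e q b)) }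
    where
    only-e3 : ∀ e .(q : e ≢ e1) → e ≡ e1 ⊎ e ≡ e3 → (e , q) ≡ (e3 , e3≢e1)
    only-e3 e q (inj₁ e≡e1) = ⊥-elim-irr (q e≡e1)
    only-e3 e q (inj₂ e≡e3) = Sub-≡ e≡e3
  lower-labels′ (suc j) with lowerLabels j
  ... | ℓ , bℓ , only = (ℓ , boundary≢e1 bℓ) , bot′-old⁺ ℓ _ j bℓ , λ { (e , q) b → Sub-≡ (only e (bot′-old⁻ e q j b)) }

  isFlow′ : IsFlow B′
  isFlow′ = record
    { finiteV     = restrict (≢? _≟V_ w) (proj₁ finiteV) , λ { (v , p) → restrict-complete (≢? _≟V_ w) p (proj₂ finiteV v) }
    ; finiteE     = restrict (≢? F._≟E_ e1) (proj₁ finiteE) , λ { (e , q) → restrict-complete (≢? F._≟E_ e1) q (proj₂ finiteE e) }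
    ; upperArity  = upper′
    ; lowerArity  = lower′
    ; inE-top     = λ i → lift-boundary⁺ (top (inE i)) _ i (inE-top i)
    ; inE-unique  = λ { i (e , q) t → Sub-≡ (inE-unique i e (lift-boundary⁻ (top e) _ i t)) }
    ; lowerLabels = lower-labels′
    ; acyclic     = R.acyclic acyclic
    ; polarity    = (λ e → F.pol (Sub.val e)) , R.polarised F.pol-ok
    }
  private
    module F′ = FlowFacts B′ isFlow′

  fewer-vertices′ : length (proj₁ (IsFlow.finiteV isFlow′)) < length (proj₁ finiteV)
  fewer-vertices′ = restrict-shorter (≢? _≟V_ w) (proj₂ finiteV w) (λ w≢w → w≢w refl)

  -- a simple edge of B on a cycle of B′ is simple in B′: it is not edge 2,
  -- which hangs from a weakening, nor edge 3, which ends in the boundary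
  simple′ : (c : AICycle B′) → ∀ e .(q : e ≢ e1) → (e , q) ∈ AICycle.edges c → SimpleEdge B e → SimpleEdge B′ (e , q)
  simple′ c e q e∈ (u₀ , w₀ , t₀ , hu₀ , b₀ , hw₀) with u₀ ≟V u | w₀ ≟V w
  ... | yes refl | _ with lower-u e t₀
  ...   | inj₁ e≡e1 = ⊥-elim-irr (q e≡e1)
  ...   | inj₂ refl = ⊥-elim (F′.weakening-off-cycles weak c e∈ (top′-vertex⁺ e2 q u u≢w t₀))
    where
    weak : kind′ (u , u≢w) ≡ weakening
    weak with kind′-cases u u≢w
    ... | inj₁ (_ , isWeak) = isWeak
    ... | inj₂ (u≢u , _)    = ⊥-elim (u≢u refl)
  simple′ c e q e∈ (u₀ , w₀ , t₀ , hu₀ , b₀ , hw₀) | no _ | yes refl with upper-w e b₀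
  ...   | inj₁ e≡e1 = ⊥-elim-irr (q e≡e1)
  ...   | inj₂ refl with proj₂ (F′.path-edge-ends (AICycle.path c) e∈)
  ...     | _ , b = ⊥-elim (inj₂≢inj₁ (trans (sym (bot′-new⁺ e3 q b3)) b))
  simple′ c e q e∈ (u₀ , w₀ , t₀ , hu₀ , b₀ , hw₀) | no u₀≢u | no w₀≢w =
    (u₀ , u₀≢w) , (w₀ , w₀≢w) , top′-vertex⁺ e q u₀ u₀≢w t₀ , kept u₀≢u hu₀ , bot′-vertex⁺ e q w₀ w₀≢w b₀ , kept w₀≢u hw₀
    where
    u₀≢w : u₀ ≢ w
    u₀≢w u₀≡w = interaction≢cut (trans (sym hu₀) (trans (cong kind u₀≡w) hw))
    w₀≢u : w₀ ≢ u
    w₀≢u w₀≡u = interaction≢cut (trans (sym hu) (trans (cong kind (sym w₀≡u)) hw₀))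
    kept : ∀ {v κ} .{p : v ≢ w} → v ≢ u → kind v ≡ κ → kind′ (v , p) ≡ κ
    kept {v} {p = p} v≢u hv with kind′-cases v p
    ... | inj₁ (v≡u , _) = ⊥-elim (v≢u v≡u)
    ... | inj₂ (_ , same) = trans same hv

  all-fragile′ : AllCyclesFragile B → AllCyclesFragile B′
  all-fragile′ fragile c with fragile (R.ai-cycle c)
  ... | _ , e∈ , simple with ∈-map⁻ Sub.val e∈
  ...   | (e , q) , e∈′ , refl = (e , q) , e∈′ , simple′ c e q e∈′ simple

module CoweakenedCopy {h k : ℕ} (B : Raw h k) (wf : IsFlow B) (sd : SimpleEdgeData B) where
  open Raw B
  open IsFlow wf
  open SimpleEdgeData sd
  open Coweakened B wf u w e1 e2 hu t1 e2≢e1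
  private
    module F = FlowFacts B wf

  B″ : Raw (suc h) k
  B″ = flow

  w≢u : w ≢ u
  w≢u w≡u = u≢w (sym w≡u)

  kind″-cases : ∀ v .(p : v ≢ u) → (v ≡ w × kind″ (v , p) ≡ coweakening) ⊎ (v ≢ w × kind″ (v , p) ≡ kind v)
  kind″-cases v p with v ≟V w
  ... | yes v≡w = inj₁ (v≡w , refl)
  ... | no v≢w  = inj₂ (v≢w , refl)

  lift-vertex⁻ : ∀ x p v .pv → lift x p ≡ inj₁ (v , pv) → x ≡ inj₁ v
  lift-vertex⁻ (inj₁ _) p v pv eq = cong inj₁ (cong Sub.val (inj₁-injective eq))

  lift-vertex⁺ : ∀ x p v .pv → x ≡ inj₁ v → lift x p ≡ inj₁ (v , pv)
  lift-vertex⁺ .(inj₁ v) p v pv refl = refl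

  lift-boundary⁻ : ∀ x p j → lift x p ≡ inj₂ j → x ≡ inj₂ j
  lift-boundary⁻ (inj₂ _) p j eq = cong inj₂ (inj₂-injective eq)

  lift-boundary⁺ : ∀ x p j → x ≡ inj₂ j → lift x p ≡ inj₂ j
  lift-boundary⁺ .(inj₂ j) p j refl = refl

  bot″-vertex⁻ : ∀ e .(q : e ≢ e1) v .(p : v ≢ u) → bot″ (e , q) ≡ inj₁ (v , p) → bot e ≡ inj₁ v
  bot″-vertex⁻ e q v p = lift-vertex⁻ (bot e) _ v p

  bot″-vertex⁺ : ∀ e .(q : e ≢ e1) v .(p : v ≢ u) → bot e ≡ inj₁ v → bot″ (e , q) ≡ inj₁ (v , p)
  bot″-vertex⁺ e q v p = lift-vertex⁺ (bot e) _ v p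

  top″-vertex⁻ : ∀ e .(q : e ≢ e1) v .(p : v ≢ u) → top″ (e , q) ≡ inj₁ (v , p) → top e ≡ inj₁ v
  top″-vertex⁻ e q v p t with top e
  ... | inj₁ v₀ with v₀ ≟V u
  ...   | no _ = cong inj₁ (cong Sub.val (inj₁-injective t))

  top″-vertex⁺ : ∀ e .(q : e ≢ e1) v .(p : v ≢ u) → top e ≡ inj₁ v → top″ (e , q) ≡ inj₁ (v , p)
  top″-vertex⁺ e q v p t with top e | t
  ... | .(inj₁ v) | refl with v ≟V u
  ...   | yes v≡u = ⊥-elim-irr (p v≡u)
  ...   | no _    = refl

  top″-new⁻ : ∀ e .(q : e ≢ e1) → top″ (e , q) ≡ inj₂ zero → top e ≡ inj₁ u
  top″-new⁻ e q t with top e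
  ... | inj₁ v₀ with v₀ ≟V u
  ...   | yes v₀≡u = cong inj₁ v₀≡u

  top″-new⁺ : ∀ e .(q : e ≢ e1) → top e ≡ inj₁ u → top″ (e , q) ≡ inj₂ zero
  top″-new⁺ e q t with top e | t
  ... | .(inj₁ u) | refl with u ≟V u
  ...   | yes _  = refl
  ...   | no u≢u = ⊥-elim (u≢u refl)

  top″-old⁻ : ∀ e .(q : e ≢ e1) i → top″ (e , q) ≡ inj₂ (suc i) → top e ≡ inj₂ i
  top″-old⁻ e q i t with top e
  ... | inj₂ _ = cong inj₂ (Fin.suc-injective (inj₂-injective t))
  ... | inj₁ v₀ with v₀ ≟V u
  ...   | yes _ = ⊥-elim (zero≢suc (inj₂-injective t))
    where zero≢suc : ∀ {n} {i : Fin n} → Fin.zero ≢ suc i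
          zero≢suc ()

  top″-old⁺ : ∀ e .(q : e ≢ e1) i → top e ≡ inj₂ i → top″ (e , q) ≡ inj₂ (suc i)
  top″-old⁺ e q i t with top e | t
  ... | .(inj₂ i) | refl = refl

  reflection : Reflection B″ B
  reflection = record
    { vmap = Sub.val ; emap = Sub.val ; emap-injective = Sub-≡
    ; top-reflect = λ { {e , q} {v , p} → top″-vertex⁻ e q v p }
    ; bot-reflect = λ { {e , q} {v , p} → bot″-vertex⁻ e q v p }
    ; kind-reflect = kind-reflect }
    where
    kind-reflect : ∀ v → kind″ v ≡ kind (Sub.val v) ⊎ NewEnd (kind″ v)
    kind-reflect (v , p) with kind″-cases v p
    ... | inj₁ (_ , coweak) = inj₂ (inj₂ coweak)
    ... | inj₂ (_ , same)   = inj₁ same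
  private
    module R = Reflect reflection

  upper″ : ∀ v′ → HasExactly (upArity (kind″ v′)) (λ e → bot″ e ≡ inj₁ v′)
  upper″ (v , p) with kind″-cases v p
  ... | inj₁ (refl , coweak) = subst (λ κ → HasExactly (upArity κ) (λ e → bot″ e ≡ inj₁ (v , p))) (sym coweak)
          ((e3 , e3≢e1) , bot″-vertex⁺ e3 e3≢e1 w p b3 , λ { (e , q) b → only-e3 e q (upper-w e (bot″-vertex⁻ e q w p b)) })
    where
    only-e3 : ∀ e .(q : e ≢ e1) → e ≡ e1 ⊎ e ≡ e3 → (e , q) ≡ (e3 , e3≢e1)
    only-e3 e q (inj₁ e≡e1) = ⊥-elim-irr (q e≡e1)
    only-e3 e q (inj₂ e≡e3) = Sub-≡ e≡e3
  ... | inj₂ (v≢w , same) = subst (λ κ → HasExactly (upArity κ) (λ e → bot″ e ≡ inj₁ (v , p))) (sym same)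
          (exactly-without (upArity (kind v)) (λ b e≡e1 → v≢w (inj₁-injective (trans (sym b) (trans (cong bot e≡e1) b1))))
             (λ e q b → bot″-vertex⁺ e q v p b) (λ e q b → bot″-vertex⁻ e q v p b) (upperArity v))

  lower″ : ∀ v′ → HasExactly (lowArity (kind″ v′)) (λ e → top″ e ≡ inj₁ v′)
  lower″ (v , p) with kind″-cases v p
  ... | inj₁ (refl , coweak) = subst (λ κ → HasExactly (lowArity κ) (λ e → top″ e ≡ inj₁ (v , p))) (sym coweak)
          (λ { (e , q) t → cutNoLower B wf w hw e (top″-vertex⁻ e q w p t) })
  ... | inj₂ (v≢w , same) = subst (λ κ → HasExactly (lowArity κ) (λ e → top″ e ≡ inj₁ (v , p))) (sym same)
          (exactly-without (lowArity (kind v)) (λ t e≡e1 → p (inj₁-injective (trans (sym t) (trans (cong top e≡e1) t1))))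
             (λ e q t → top″-vertex⁺ e q v p t) (λ e q t → top″-vertex⁻ e q v p t) (lowerArity v))

  inE-top″ : ∀ i → top″ (inE″ i) ≡ inj₂ i
  inE-top″ zero    = top″-new⁺ e2 e2≢e1 t2
  inE-top″ (suc i) = top″-old⁺ (inE i) _ i (inE-top i)

  inE-unique″ : ∀ i e → top″ e ≡ inj₂ i → e ≡ inE″ i
  inE-unique″ zero (e , q) t with lower-u e (top″-new⁻ e q t)
  ... | inj₁ e≡e1 = ⊥-elim-irr (q e≡e1)
  ... | inj₂ e≡e2 = Sub-≡ e≡e2
  inE-unique″ (suc i) (e , q) t = Sub-≡ (inE-unique i e (top″-old⁻ e q i t))

  lower-labels″ : ∀ j → HasExactly 1 (λ e → bot″ e ≡ inj₂ j)
  lower-labels″ j with lowerLabels j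
  ... | ℓ , bℓ , only = (ℓ , boundary≢e1 bℓ) , lift-boundary⁺ (bot ℓ) _ j bℓ
                      , λ { (e , q) b → Sub-≡ (only e (lift-boundary⁻ (bot e) _ j b)) }

  isFlow″ : IsFlow B″
  isFlow″ = record
    { finiteV     = restrict (≢? _≟V_ u) (proj₁ finiteV) , λ { (v , p) → restrict-complete (≢? _≟V_ u) p (proj₂ finiteV v) }
    ; finiteE     = restrict (≢? F._≟E_ e1) (proj₁ finiteE) , λ { (e , q) → restrict-complete (≢? F._≟E_ e1) q (proj₂ finiteE e) }
    ; upperArity  = upper″
    ; lowerArity  = lower″
    ; inE-top     = inE-top″
    ; inE-unique  = inE-unique″
    ; lowerLabels = lower-labels″
    ; acyclic     = R.acyclic acyclic
    ; polarity    = (λ e → F.pol (Sub.val e)) , R.polarised F.pol-ok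
    }
  private
    module F″ = FlowFacts B″ isFlow″

  fewer-vertices″ : length (proj₁ (IsFlow.finiteV isFlow″)) < length (proj₁ finiteV)
  fewer-vertices″ = restrict-shorter (≢? _≟V_ u) (proj₂ finiteV u) (λ u≢u → u≢u refl)

  -- a simple edge of B on a cycle of B″ is simple in B″: it is not edge 2,
  -- which starts in the boundary, nor edge 3, which ends in a coweakening
  simple″ : (c : AICycle B″) → ∀ e .(q : e ≢ e1) → (e , q) ∈ AICycle.edges c → SimpleEdge B e → SimpleEdge B″ (e , q)
  simple″ c e q e∈ (u₀ , w₀ , t₀ , hu₀ , b₀ , hw₀) with u₀ ≟V u | w₀ ≟V w
  ... | yes refl | _ with lower-u e t₀
  ...   | inj₁ e≡e1 = ⊥-elim-irr (q e≡e1)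
  ...   | inj₂ refl with proj₁ (F″.path-edge-ends (AICycle.path c) e∈)
  ...     | _ , t = ⊥-elim (inj₂≢inj₁ (trans (sym (top″-new⁺ e2 q t2)) t))
  simple″ c e q e∈ (u₀ , w₀ , t₀ , hu₀ , b₀ , hw₀) | no _ | yes refl with upper-w e b₀
  ...   | inj₁ e≡e1 = ⊥-elim-irr (q e≡e1)
  ...   | inj₂ refl = ⊥-elim (F″.coweakening-off-cycles coweak c e∈ (bot″-vertex⁺ e3 q w w≢u b₀))
    where
    coweak : kind″ (w , w≢u) ≡ coweakening
    coweak with kind″-cases w w≢u
    ... | inj₁ (_ , isCoweak) = isCoweak
    ... | inj₂ (w≢w , _)      = ⊥-elim (w≢w refl)
  simple″ c e q e∈ (u₀ , w₀ , t₀ , hu₀ , b₀ , hw₀) | no u₀≢u | no w₀≢w =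
    (u₀ , u₀≢u) , (w₀ , w₀≢u) , top″-vertex⁺ e q u₀ u₀≢u t₀ , kept u₀≢w hu₀ , bot″-vertex⁺ e q w₀ w₀≢u b₀ , kept w₀≢w hw₀
    where
    u₀≢w : u₀ ≢ w
    u₀≢w u₀≡w = interaction≢cut (trans (sym hu₀) (trans (cong kind u₀≡w) hw))
    w₀≢u : w₀ ≢ u
    w₀≢u w₀≡u = interaction≢cut (trans (sym hu) (trans (cong kind (sym w₀≡u)) hw₀))
    kept : ∀ {v κ} .{p : v ≢ u} → v ≢ w → kind v ≡ κ → kind″ (v , p) ≡ κ
    kept {v} {p = p} v≢w hv with kind″-cases v p
    ... | inj₁ (v≡w , _) = ⊥-elim (v≢w v≡w)
    ... | inj₂ (_ , same) = trans same hv

  all-fragile″ : AllCyclesFragile B → AllCyclesFragile B″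
  all-fragile″ fragile c with fragile (R.ai-cycle c)
  ... | _ , e∈ , simple with ∈-map⁻ Sub.val e∈
  ...   | (e , q) , e∈′ , refl = (e , q) , e∈′ , simple″ c e q e∈′ simple

-- The glued flow C

pattern in′ a   = inj₁ a
pattern in″ a   = inj₂ (inj₁ a)
pattern coco i  = inj₂ (inj₂ (inj₁ i))
pattern contr j = inj₂ (inj₂ (inj₂ j))

module Glued {h k : ℕ} (D′ : Raw h (suc k)) (D″ : Raw (suc h) k) (wf₁ : IsFlow D′) (wf₂ : IsFlow D″) where
  open Glue D′ D″
  private
    module I₁ = IsFlow wf₁
    module I₂ = IsFlow wf₂

  C : Raw h k
  C = flow

  pol₁ : D₁.E → Bool
  pol₁ = polarityOf wf₁

  pol₂ : D₂.E → Bool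
  pol₂ = polarityOf wf₂

  low₁ : Fin (suc k) → D₁.E
  low₁ j = proj₁ (I₁.lowerLabels j)

  low₁-bot : ∀ j → D₁.bot (low₁ j) ≡ inj₂ j
  low₁-bot j = proj₁ (proj₂ (I₁.lowerLabels j))

  low₁-unique : ∀ j e → D₁.bot e ≡ inj₂ j → e ≡ low₁ j
  low₁-unique j = proj₂ (proj₂ (I₁.lowerLabels j))

  low₂ : Fin k → D₂.E
  low₂ j = proj₁ (I₂.lowerLabels j)

  low₂-bot : ∀ j → D₂.bot (low₂ j) ≡ inj₂ j
  low₂-bot j = proj₁ (proj₂ (I₂.lowerLabels j))

  low₂-unique : ∀ j e → D₂.bot e ≡ inj₂ j → e ≡ low₂ j
  low₂-unique j = proj₂ (proj₂ (I₂.lowerLabels j))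

  -- the edge 3 of the construction: lower edge 0 of D′, identified with
  -- upper edge 0 of D″
  bridge : GE
  bridge = in′ (low₁ zero)

  gtop₁-in′ : ∀ y {a} → gtop₁ y ≡ inj₁ (in′ a) → y ≡ inj₁ a
  gtop₁-in′ (inj₁ _) refl = refl
  gtop₁-in′ (inj₂ _) ()

  gtop₁-coco : ∀ y {i} → gtop₁ y ≡ inj₁ (coco i) → y ≡ inj₂ i
  gtop₁-coco (inj₁ _) ()
  gtop₁-coco (inj₂ _) refl = refl

  gtop₁-in″ : ∀ y {a} → gtop₁ y ≢ inj₁ (in″ a)
  gtop₁-in″ (inj₁ _) ()
  gtop₁-in″ (inj₂ _) ()

  gtop₁-contr : ∀ y {j} → gtop₁ y ≢ inj₁ (contr j)
  gtop₁-contr (inj₁ _) ()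
  gtop₁-contr (inj₂ _) ()

  gtop₁-boundary : ∀ y {i} → gtop₁ y ≢ inj₂ i
  gtop₁-boundary (inj₁ _) ()
  gtop₁-boundary (inj₂ _) ()

  fromBot₂-in″ : ∀ y {a} → fromBot₂ y ≡ inj₁ (in″ a) → y ≡ inj₁ a
  fromBot₂-in″ (inj₁ _) refl = refl
  fromBot₂-in″ (inj₂ _) ()

  fromBot₂-contr : ∀ y {j} → fromBot₂ y ≡ inj₁ (contr j) → y ≡ inj₂ j
  fromBot₂-contr (inj₁ _) ()
  fromBot₂-contr (inj₂ _) refl = refl

  fromBot₂-in′ : ∀ y {a} → fromBot₂ y ≢ inj₁ (in′ a)
  fromBot₂-in′ (inj₁ _) ()
  fromBot₂-in′ (inj₂ _) ()

  fromBot₂-coco : ∀ y {i} → fromBot₂ y ≢ inj₁ (coco i)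
  fromBot₂-coco (inj₁ _) ()
  fromBot₂-coco (inj₂ _) ()

  fromBot₂-boundary : ∀ y {j} → fromBot₂ y ≢ inj₂ j
  fromBot₂-boundary (inj₁ _) ()
  fromBot₂-boundary (inj₂ _) ()

  gbot₁-in′ : ∀ y {a} → gbot₁ y ≡ inj₁ (in′ a) → y ≡ inj₁ a
  gbot₁-in′ (inj₁ _) refl = refl
  gbot₁-in′ (inj₂ zero) eq = ⊥-elim (fromBot₂-in′ _ eq)
  gbot₁-in′ (inj₂ (suc _)) ()

  gbot₁-in″ : ∀ y {a} → gbot₁ y ≡ inj₁ (in″ a) → y ≡ inj₂ zero × D₂.bot (D₂.inE zero) ≡ inj₁ a
  gbot₁-in″ (inj₁ _) ()
  gbot₁-in″ (inj₂ zero) eq = refl , fromBot₂-in″ _ eq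
  gbot₁-in″ (inj₂ (suc _)) ()

  gbot₁-contr : ∀ y {j} → gbot₁ y ≡ inj₁ (contr j)
              → y ≡ inj₂ (suc j) ⊎ (y ≡ inj₂ zero × D₂.bot (D₂.inE zero) ≡ inj₂ j)
  gbot₁-contr (inj₁ _) ()
  gbot₁-contr (inj₂ zero) eq = inj₂ (refl , fromBot₂-contr _ eq)
  gbot₁-contr (inj₂ (suc _)) refl = inj₁ refl

  gbot₁-coco : ∀ y {i} → gbot₁ y ≢ inj₁ (coco i)
  gbot₁-coco (inj₁ _) ()
  gbot₁-coco (inj₂ zero) eq = fromBot₂-coco _ eq
  gbot₁-coco (inj₂ (suc _)) ()

  gbot₁-boundary : ∀ y {j} → gbot₁ y ≢ inj₂ j
  gbot₁-boundary (inj₁ _) ()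
  gbot₁-boundary (inj₂ zero) eq = fromBot₂-boundary _ eq
  gbot₁-boundary (inj₂ (suc _)) ()

  gtop₂-in″ : ∀ y .p {a} → gtop₂ y p ≡ inj₁ (in″ a) → y ≡ inj₁ a
  gtop₂-in″ (inj₁ _) p refl = refl
  gtop₂-in″ (inj₂ zero) p eq = ⊥-elim-irr (p refl)
  gtop₂-in″ (inj₂ (suc _)) p ()

  gtop₂-coco : ∀ y .p {i} → gtop₂ y p ≡ inj₁ (coco i) → y ≡ inj₂ (suc i)
  gtop₂-coco (inj₁ _) p ()
  gtop₂-coco (inj₂ zero) p eq = ⊥-elim-irr (p refl)
  gtop₂-coco (inj₂ (suc _)) p refl = refl

  gtop₂-in′ : ∀ y .p {a} → gtop₂ y p ≢ inj₁ (in′ a)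
  gtop₂-in′ (inj₁ _) p ()
  gtop₂-in′ (inj₂ zero) p eq = ⊥-elim-irr (p refl)
  gtop₂-in′ (inj₂ (suc _)) p ()

  gtop₂-contr : ∀ y .p {j} → gtop₂ y p ≢ inj₁ (contr j)
  gtop₂-contr (inj₁ _) p ()
  gtop₂-contr (inj₂ zero) p eq = ⊥-elim-irr (p refl)
  gtop₂-contr (inj₂ (suc _)) p ()

  gtop₂-boundary : ∀ y .p {i} → gtop₂ y p ≢ inj₂ i
  gtop₂-boundary (inj₁ _) p ()
  gtop₂-boundary (inj₂ zero) p eq = ⊥-elim-irr (p refl)
  gtop₂-boundary (inj₂ (suc _)) p ()

  gtop₂-in″⁺ : ∀ y .p a → y ≡ inj₁ a → gtop₂ y p ≡ inj₁ (in″ a)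
  gtop₂-in″⁺ .(inj₁ a) p a refl = refl

  gtop₂-coco⁺ : ∀ y .p i → y ≡ inj₂ (suc i) → gtop₂ y p ≡ inj₁ (coco i)
  gtop₂-coco⁺ .(inj₂ (suc i)) p i refl = refl

  top-in′ : ∀ e {a} → gtop e ≡ inj₁ (in′ a) → Σ D₁.E λ x → e ≡ in′ x × D₁.top x ≡ inj₁ a
  top-in′ (in′ x)       eq = x , refl , gtop₁-in′ (D₁.top x) eq
  top-in′ (in″ (x , p)) eq = ⊥-elim (gtop₂-in′ (D₂.top x) p eq)
  top-in′ (coco _) ()
  top-in′ (contr _) ()

  top-in″ : ∀ e {a} → gtop e ≡ inj₁ (in″ a) → Σ E₂ λ x′ → e ≡ in″ x′ × D₂.top (Sub.val x′) ≡ inj₁ a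
  top-in″ (in′ x)       eq = ⊥-elim (gtop₁-in″ (D₁.top x) eq)
  top-in″ (in″ (x , p)) eq = (x , p) , refl , gtop₂-in″ (D₂.top x) p eq
  top-in″ (coco _) ()
  top-in″ (contr _) ()

  top-coco : ∀ e {i} → gtop e ≡ inj₁ (coco i)
           → e ≡ in′ (D₁.inE i) ⊎ Σ E₂ λ x′ → e ≡ in″ x′ × Sub.val x′ ≡ D₂.inE (suc i)
  top-coco (in′ x) {i} eq       = inj₁ (cong in′ (I₁.inE-unique i x (gtop₁-coco (D₁.top x) eq)))
  top-coco (in″ (x , p)) {i} eq = inj₂ ((x , p) , refl , I₂.inE-unique (suc i) x (gtop₂-coco (D₂.top x) p eq))
  top-coco (coco _) ()
  top-coco (contr _) ()

  top-contr : ∀ e {j} → gtop e ≡ inj₁ (contr j) → e ≡ contr j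
  top-contr (in′ x)       eq = ⊥-elim (gtop₁-contr (D₁.top x) eq)
  top-contr (in″ (x , p)) eq = ⊥-elim (gtop₂-contr (D₂.top x) p eq)
  top-contr (coco _) ()
  top-contr (contr _) refl = refl

  top-boundary : ∀ e {i} → gtop e ≡ inj₂ i → e ≡ coco i
  top-boundary (in′ x)       eq = ⊥-elim (gtop₁-boundary (D₁.top x) eq)
  top-boundary (in″ (x , p)) eq = ⊥-elim (gtop₂-boundary (D₂.top x) p eq)
  top-boundary (coco _) refl = refl
  top-boundary (contr _) ()

  bot-in′ : ∀ e {a} → gbot e ≡ inj₁ (in′ a) → Σ D₁.E λ x → e ≡ in′ x × D₁.bot x ≡ inj₁ a
  bot-in′ (in′ x)       eq = x , refl , gbot₁-in′ (D₁.bot x) eq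
  bot-in′ (in″ (x , p)) eq = ⊥-elim (fromBot₂-in′ (D₂.bot x) eq)
  bot-in′ (coco _) ()
  bot-in′ (contr _) ()

  bot-in″ : ∀ e {a} → gbot e ≡ inj₁ (in″ a)
          → (Σ E₂ λ x′ → e ≡ in″ x′ × D₂.bot (Sub.val x′) ≡ inj₁ a) ⊎ (e ≡ bridge × D₂.bot (D₂.inE zero) ≡ inj₁ a)
  bot-in″ (in′ x) eq with gbot₁-in″ (D₁.bot x) eq
  ... | b , b₂ = inj₂ (cong in′ (low₁-unique zero x b) , b₂)
  bot-in″ (in″ (x , p)) eq = inj₁ ((x , p) , refl , fromBot₂-in″ (D₂.bot x) eq)
  bot-in″ (coco _) ()
  bot-in″ (contr _) ()

  bot-coco : ∀ e {i} → gbot e ≡ inj₁ (coco i) → e ≡ coco i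
  bot-coco (in′ x)       eq = ⊥-elim (gbot₁-coco (D₁.bot x) eq)
  bot-coco (in″ (x , p)) eq = ⊥-elim (fromBot₂-coco (D₂.bot x) eq)
  bot-coco (coco _) refl = refl
  bot-coco (contr _) ()

  bot-contr : ∀ e {j} → gbot e ≡ inj₁ (contr j)
    → e ≡ in′ (low₁ (suc j)) ⊎ (e ≡ bridge × D₂.bot (D₂.inE zero) ≡ inj₂ j)
      ⊎ Σ E₂ λ x′ → e ≡ in″ x′ × Sub.val x′ ≡ low₂ j
  bot-contr (in′ x) {j} eq with gbot₁-contr (D₁.bot x) eq
  ... | inj₁ b         = inj₁ (cong in′ (low₁-unique (suc j) x b))
  ... | inj₂ (b , b₂)  = inj₂ (inj₁ (cong in′ (low₁-unique zero x b) , b₂))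
  bot-contr (in″ (x , p)) {j} eq = inj₂ (inj₂ ((x , p) , refl , low₂-unique j x (fromBot₂-contr (D₂.bot x) eq)))
  bot-contr (coco _) ()
  bot-contr (contr _) ()

  bot-boundary : ∀ e {j} → gbot e ≡ inj₂ j → e ≡ contr j
  bot-boundary (in′ x)       eq = ⊥-elim (gbot₁-boundary (D₁.bot x) eq)
  bot-boundary (in″ (x , p)) eq = ⊥-elim (fromBot₂-boundary (D₂.bot x) eq)
  bot-boundary (coco _) ()
  bot-boundary (contr _) refl = refl

  -- Edges of D″ as edges of C: upper edge 0 becomes the bridge

  starts-at-0? : ∀ x → Dec (D₂.top x ≡ inj₂ zero)
  starts-at-0? x = ≡-dec D₂._≟V_ Fin._≟_ (D₂.top x) (inj₂ zero)

  φ : D₂.E → GE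
  φ x with starts-at-0? x
  ... | yes _ = bridge
  ... | no q  = in″ (x , q)

  φ-cases : ∀ x → (D₂.top x ≡ inj₂ zero × φ x ≡ bridge) ⊎ (Σ (D₂.top x ≢ inj₂ zero) λ q → φ x ≡ in″ (x , q))
  φ-cases x with starts-at-0? x
  ... | yes t = inj₁ (t , refl)
  ... | no q  = inj₂ (q , refl)

  φ-bridge : ∀ x → D₂.top x ≡ inj₂ zero → φ x ≡ bridge
  φ-bridge x t with starts-at-0? x
  ... | yes _ = refl
  ... | no q  = ⊥-elim (q t)

  φ-in″ : ∀ x .(q : D₂.top x ≢ inj₂ zero) → φ x ≡ in″ (x , q)
  φ-in″ x q with starts-at-0? x
  ... | yes t = ⊥-elim-irr (q t)
  ... | no _  = refl

  φ-injective : ∀ x x′ → φ x ≡ φ x′ → x ≡ x′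
  φ-injective x x′ eq with φ-cases x | φ-cases x′
  ... | inj₁ (t , p) | inj₁ (t′ , p′) = trans (I₂.inE-unique zero x t) (sym (I₂.inE-unique zero x′ t′))
  ... | inj₁ (_ , p) | inj₂ (_ , p′)  = ⊥-elim (inj₁≢inj₂ (trans (sym p) (trans eq p′)))
  ... | inj₂ (_ , p) | inj₁ (_ , p′)  = ⊥-elim (inj₂≢inj₁ (trans (sym p) (trans eq p′)))
  ... | inj₂ (_ , p) | inj₂ (_ , p′)  = cong Sub.val (inj₁-injective (inj₂-injective (trans (sym p) (trans eq p′))))

  φ-bot : ∀ x y → D₂.bot x ≡ y → gbot (φ x) ≡ fromBot₂ y
  φ-bot x y b with φ-cases x
  ... | inj₁ (t , p) rewrite p | I₂.inE-unique zero x t = trans (cong gbot₁ (low₁-bot zero)) (cong fromBot₂ b)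
  ... | inj₂ (q , p) rewrite p = cong fromBot₂ b

  φ-top : ∀ x a → D₂.top x ≡ inj₁ a → gtop (φ x) ≡ inj₁ (in″ a)
  φ-top x a t with φ-cases x
  ... | inj₁ (t′ , _) = ⊥-elim (inj₁≢inj₂ (trans (sym t) t′))
  ... | inj₂ (q , p) rewrite p = gtop₂-in″⁺ (D₂.top x) q a t

  upperC : ∀ v → HasExactly (upArity (gkind v)) (λ e → gbot e ≡ inj₁ v)
  upperC (in′ a) = exactly-transport _ (λ x _ → in′ x) (λ x b → cong gbot₁ b)
    (λ e b → from-D′ e (bot-in′ e b)) (λ _ _ _ _ eq → inj₁-injective eq) (I₁.upperArity a)
    where
    from-D′ : ∀ e → (Σ D₁.E λ x → e ≡ in′ x × D₁.bot x ≡ inj₁ a) → Σ D₁.E λ x → Σ (D₁.bot x ≡ inj₁ a) λ _ → in′ x ≡ e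
    from-D′ e (x , eq , b) = x , b , sym eq
  upperC (in″ a) = exactly-transport _ (λ x _ → φ x) (λ x b → φ-bot x _ b)
    (λ e b → from-D″ e (bot-in″ e b)) (λ x x′ _ _ → φ-injective x x′) (I₂.upperArity a)
    where
    from-D″ : ∀ e → _ → Σ D₂.E λ x → Σ (D₂.bot x ≡ inj₁ a) λ _ → φ x ≡ e
    from-D″ e (inj₁ ((x , p) , refl , b)) = x , b , φ-in″ x p
    from-D″ e (inj₂ (refl , b))          = D₂.inE zero , b , φ-bridge _ (I₂.inE-top zero)
  upperC (coco i) = coco i , refl , λ e b → bot-coco e b
  upperC (contr j) = in′ (low₁ (suc j)) , φ (low₂ j) , distinct , cong gbot₁ (low₁-bot (suc j))
                   , φ-bot (low₂ j) _ (low₂-bot j) , only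
    where
    distinct : in′ (low₁ (suc j)) ≢ φ (low₂ j)
    distinct eq with φ-cases (low₂ j)
    ... | inj₁ (_ , p) = suc≢zero (inj₂-injective (trans (sym (low₁-bot (suc j)))
                                    (trans (cong D₁.bot (inj₁-injective (trans eq p))) (low₁-bot zero))))
      where suc≢zero : ∀ {n} {i : Fin n} → Fin.suc i ≢ zero
            suc≢zero ()
    ... | inj₂ (_ , p) = inj₁≢inj₂ (trans eq p)
    only : ∀ e → gbot e ≡ inj₁ (contr j) → e ≡ in′ (low₁ (suc j)) ⊎ e ≡ φ (low₂ j)
    only e b with bot-contr e b
    ... | inj₁ eq = inj₁ eq
    ... | inj₂ (inj₁ (eq , b₂)) = inj₂ (trans eq (sym (φ-bridge (low₂ j)
                                      (trans (cong D₂.top (sym (low₂-unique j _ b₂))) (I₂.inE-top zero)))))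
    ... | inj₂ (inj₂ ((x , p) , refl , refl)) = inj₂ (sym (φ-in″ x p))

  lowerC : ∀ v → HasExactly (lowArity (gkind v)) (λ e → gtop e ≡ inj₁ v)
  lowerC (in′ a) = exactly-transport _ (λ x _ → in′ x) (λ x t → cong gtop₁ t)
    (λ e t → from-D′ e (top-in′ e t)) (λ _ _ _ _ eq → inj₁-injective eq) (I₁.lowerArity a)
    where
    from-D′ : ∀ e → (Σ D₁.E λ x → e ≡ in′ x × D₁.top x ≡ inj₁ a) → Σ D₁.E λ x → Σ (D₁.top x ≡ inj₁ a) λ _ → in′ x ≡ e
    from-D′ e (x , eq , t) = x , t , sym eq
  lowerC (in″ a) = exactly-transport _ (λ x _ → φ x) (λ x t → φ-top x a t)
    (λ e t → from-D″ e (top-in″ e t)) (λ x x′ _ _ → φ-injective x x′) (I₂.lowerArity a)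
    where
    from-D″ : ∀ e → _ → Σ D₂.E λ x → Σ (D₂.top x ≡ inj₁ a) λ _ → φ x ≡ e
    from-D″ e ((x , p) , refl , t) = x , t , φ-in″ x p
  lowerC (coco i) = in′ (D₁.inE i) , in″ (D₂.inE (suc i) , not-0) , (λ ()) , cong gtop₁ (I₁.inE-top i)
                  , gtop₂-coco⁺ _ not-0 i (I₂.inE-top (suc i)) , only
    where
    not-0 : D₂.top (D₂.inE (suc i)) ≢ inj₂ zero
    not-0 eq = suc≢zero (inj₂-injective (trans (sym (I₂.inE-top (suc i))) eq))
      where suc≢zero : ∀ {n} {i : Fin n} → Fin.suc i ≢ zero
            suc≢zero ()
    only : ∀ e → gtop e ≡ inj₁ (coco i) → e ≡ in′ (D₁.inE i) ⊎ e ≡ in″ (D₂.inE (suc i) , not-0)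
    only e t with top-coco e t
    ... | inj₁ eq = inj₁ eq
    ... | inj₂ ((x , p) , refl , x≡) = inj₂ (cong in″ (Sub-≡ x≡))
  lowerC (contr j) = contr j , refl , λ e t → top-contr e t

  -- Acyclicity: ranking the cocontractions 0, D′ 1, D″ 2 and the
  -- contractions 3, every edge goes weakly down in rank, so a directed
  -- cycle stays within D′ or within D″

  rank : GV → ℕ
  rank (in′ _)   = 1
  rank (in″ _)   = 2
  rank (coco _)  = 0
  rank (contr _) = 3

  rankTop : GV ⊎ Fin h → ℕ
  rankTop (inj₁ v) = rank v
  rankTop (inj₂ _) = 0

  rankBot : GV ⊎ Fin k → ℕ
  rankBot (inj₁ v) = rank v
  rankBot (inj₂ _) = 3

  edge-rank : ∀ e → rankTop (gtop e) ≤ rankBot (gbot e)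
  edge-rank (in′ x) = ≤-trans (top≤1 (D₁.top x)) (1≤bot (D₁.bot x))
    where
    top≤1 : ∀ y → rankTop (gtop₁ y) ≤ 1
    top≤1 (inj₁ _) = s≤s z≤n
    top≤1 (inj₂ _) = z≤n
    1≤bot : ∀ y → 1 ≤ rankBot (gbot₁ y)
    1≤bot (inj₁ _)       = s≤s z≤n
    1≤bot (inj₂ zero) with D₂.bot (D₂.inE zero)
    ... | inj₁ _ = s≤s z≤n
    ... | inj₂ _ = s≤s z≤n
    1≤bot (inj₂ (suc _)) = s≤s z≤n
  edge-rank (in″ (x , p)) = ≤-trans (top≤2 (D₂.top x) p) (2≤bot (D₂.bot x))
    where
    top≤2 : ∀ y .p → rankTop (gtop₂ y p) ≤ 2
    top≤2 (inj₁ _) p       = ≤-refl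
    top≤2 (inj₂ zero) p    = ⊥-elim-irr (p refl)
    top≤2 (inj₂ (suc _)) p = z≤n
    2≤bot : ∀ y → 2 ≤ rankBot (fromBot₂ y)
    2≤bot (inj₁ _) = s≤s (s≤s z≤n)
    2≤bot (inj₂ _) = s≤s (s≤s z≤n)
  edge-rank (coco _)  = z≤n
  edge-rank (contr _) = ≤-refl

  step-rank : ∀ {x y} → Step C x y → rank x ≤ rank y
  step-rank (e , t , b) = subst₂ _≤_ (cong rankTop t) (cong rankBot b) (edge-rank e)

  steps-rank : ∀ {x y} → TransClosure (Step C) x y → rank x ≤ rank y
  steps-rank [ s ]    = step-rank s
  steps-rank (s ∷ ss) = ≤-trans (step-rank s) (steps-rank ss)

  no-step-into-coco : ∀ {x i} → Step C x (coco i) → ⊥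
  no-step-into-coco (e , t , b) with bot-coco e b
  ... | refl = inj₂≢inj₁ t

  no-step-from-contr : ∀ {j y} → Step C (contr j) y → ⊥
  no-step-from-contr (e , t , b) with top-contr e t
  ... | refl = inj₂≢inj₁ b

  step-D′ : ∀ {a b} → Step C (in′ a) (in′ b) → Step D′ a b
  step-D′ (e , t , b) with top-in′ e t
  ... | x , refl , t′ = x , t′ , gbot₁-in′ (D₁.bot x) b

  step-D″ : ∀ {a b} → Step C (in″ a) (in″ b) → Step D″ a b
  step-D″ (e , t , b) with top-in″ e t
  ... | (x , p) , refl , t′ = x , t′ , fromBot₂-in″ (D₂.bot x) b

  steps-D′ : ∀ {a b} → TransClosure (Step C) (in′ a) (in′ b) → TransClosure (Step D′) a b
  steps-D′ [ s ] = [ step-D′ s ]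
  steps-D′ (_∷_ {y = in′ _} s ss)   = step-D′ s ∷ steps-D′ ss
  steps-D′ (_∷_ {y = in″ _} s ss)   = ⊥-elim (2≰1 (steps-rank ss))
    where 2≰1 : ¬ (2 ≤ 1)
          2≰1 (s≤s ())
  steps-D′ (_∷_ {y = coco _} s ss)  = ⊥-elim (no-step-into-coco s)
  steps-D′ (_∷_ {y = contr _} s ss) = ⊥-elim (3≰1 (steps-rank ss))
    where 3≰1 : ¬ (3 ≤ 1)
          3≰1 (s≤s ())

  steps-D″ : ∀ {a b} → TransClosure (Step C) (in″ a) (in″ b) → TransClosure (Step D″) a b
  steps-D″ [ s ] = [ step-D″ s ]
  steps-D″ (_∷_ {y = in′ _} s ss)   = ⊥-elim (2≰1 (step-rank s))
    where 2≰1 : ¬ (2 ≤ 1)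
          2≰1 (s≤s ())
  steps-D″ (_∷_ {y = in″ _} s ss)   = step-D″ s ∷ steps-D″ ss
  steps-D″ (_∷_ {y = coco _} s ss)  = ⊥-elim (no-step-into-coco s)
  steps-D″ (_∷_ {y = contr _} s ss) = ⊥-elim (3≰2 (steps-rank ss))
    where 3≰2 : ¬ (3 ≤ 2)
          3≰2 (s≤s (s≤s ()))

  acyclicC : ∀ v → ¬ TransClosure (Step C) v v
  acyclicC (in′ a) loop = I₁.acyclic a (steps-D′ loop)
  acyclicC (in″ a) loop = I₂.acyclic a (steps-D″ loop)
  acyclicC (coco i) loop = into-coco loop
    where
    into-coco : ∀ {x} → TransClosure (Step C) x (coco i) → ⊥
    into-coco [ s ]    = no-step-into-coco s
    into-coco (_ ∷ ss) = into-coco ss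
  acyclicC (contr j) [ s ]    = no-step-from-contr s
  acyclicC (contr j) (s ∷ _)  = no-step-from-contr s

  not-at-0? : ∀ x → Dec (D₂.top x ≢ inj₂ zero)
  not-at-0? x = ¬? (starts-at-0? x)

  new : (A : Set) → List (A ⊎ (Fin h ⊎ Fin k))
  new A = map inj₂ (map inj₁ (allFin h) ++ map inj₂ (allFin k))

  new-complete : (A : Set) → ∀ x → inj₂ x ∈ new A
  new-complete A (inj₁ i) = ∈-map⁺ inj₂ (∈-++⁺ˡ (∈-map⁺ inj₁ (∈-allFin i)))
  new-complete A (inj₂ j) = ∈-map⁺ inj₂ (∈-++⁺ʳ (map inj₁ (allFin h)) (∈-map⁺ inj₂ (∈-allFin j)))

  verticesC : List GV
  verticesC = map in′ (proj₁ I₁.finiteV) ++ map inj₂ (map inj₁ (proj₁ I₂.finiteV) ++ new D₂.V)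

  verticesC-complete : ∀ v → v ∈ verticesC
  verticesC-complete (in′ a) = ∈-++⁺ˡ (∈-map⁺ in′ (proj₂ I₁.finiteV a))
  verticesC-complete (inj₂ v) = ∈-++⁺ʳ (map in′ (proj₁ I₁.finiteV)) (∈-map⁺ inj₂ (rest v))
    where
    rest : ∀ v → v ∈ map inj₁ (proj₁ I₂.finiteV) ++ new D₂.V
    rest (inj₁ a) = ∈-++⁺ˡ (∈-map⁺ inj₁ (proj₂ I₂.finiteV a))
    rest (inj₂ x) = ∈-++⁺ʳ (map inj₁ (proj₁ I₂.finiteV)) (new-complete D₂.V x)

  edgesC : List GE
  edgesC = map in′ (proj₁ I₁.finiteE) ++ map inj₂ (map inj₁ (restrict not-at-0? (proj₁ I₂.finiteE)) ++ new E₂)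

  edgesC-complete : ∀ e → e ∈ edgesC
  edgesC-complete (in′ x) = ∈-++⁺ˡ (∈-map⁺ in′ (proj₂ I₁.finiteE x))
  edgesC-complete (inj₂ e) = ∈-++⁺ʳ (map in′ (proj₁ I₁.finiteE)) (∈-map⁺ inj₂ (rest e))
    where
    rest : ∀ e → e ∈ map inj₁ (restrict not-at-0? (proj₁ I₂.finiteE)) ++ new E₂
    rest (inj₁ (x , p)) = ∈-++⁺ˡ (∈-map⁺ inj₁ (restrict-complete not-at-0? p (proj₂ I₂.finiteE x)))
    rest (inj₂ x)       = ∈-++⁺ʳ (map inj₁ (restrict not-at-0? (proj₁ I₂.finiteE))) (new-complete E₂ x)

  -- Polarity: the glued edges must have matching polarities

  record PolarityMatch : Set where
    field
      upper-match  : ∀ i → pol₁ (D₁.inE i) ≡ pol₂ (D₂.inE (suc i))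
      lower-match  : ∀ j → pol₁ (low₁ (suc j)) ≡ pol₂ (low₂ j)
      bridge-match : pol₁ (low₁ zero) ≡ pol₂ (D₂.inE zero)

  polC : GE → Bool
  polC (in′ e)       = pol₁ e
  polC (in″ (e , _)) = pol₂ e
  polC (coco i)      = pol₁ (D₁.inE i)
  polC (contr j)     = pol₁ (low₁ (suc j))

  -- the edge of D″ that a glued edge at a vertex of D″ stands for
  ψ : GE → D₂.E
  ψ (in″ (x , _)) = x
  ψ _             = D₂.inE zero

  at-D″ : ∀ e a → Incident C (in″ a) e → e ≡ bridge ⊎ Σ E₂ λ x′ → e ≡ in″ x′
  at-D″ e a (inj₁ t) with top-in″ e t
  ... | x′ , refl , _ = inj₂ (x′ , refl)
  at-D″ e a (inj₂ b) with bot-in″ e b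
  ... | inj₁ (x′ , refl , _) = inj₂ (x′ , refl)
  ... | inj₂ (refl , _)      = inj₁ refl

  ψ-injective : ∀ e e′ a → Incident C (in″ a) e → Incident C (in″ a) e′ → ψ e ≡ ψ e′ → e ≡ e′
  ψ-injective e e′ a i i′ eq with at-D″ e a i | at-D″ e′ a i′
  ... | inj₁ refl | inj₁ refl = refl
  ... | inj₁ refl | inj₂ ((x , p) , refl) = ⊥-elim-irr (p (trans (cong D₂.top (sym eq)) (I₂.inE-top zero)))
  ... | inj₂ ((x , p) , refl) | inj₁ refl = ⊥-elim-irr (p (trans (cong D₂.top eq) (I₂.inE-top zero)))
  ... | inj₂ ((x , p) , refl) | inj₂ ((x′ , p′) , refl) = cong in″ (Sub-≡ eq)

  incident-D′ : ∀ e a → Incident C (in′ a) e → Σ D₁.E λ x → e ≡ in′ x × Incident D′ a x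
  incident-D′ e a (inj₁ t) with top-in′ e t
  ... | x , refl , t′ = x , refl , inj₁ t′
  incident-D′ e a (inj₂ b) with bot-in′ e b
  ... | x , refl , b′ = x , refl , inj₂ b′

  module _ (match : PolarityMatch) where
    open PolarityMatch match

    coco-pol : ∀ e i → Incident C (coco i) e → polC e ≡ pol₁ (D₁.inE i)
    coco-pol e i (inj₁ t) with top-coco e t
    ... | inj₁ refl = refl
    ... | inj₂ ((x , p) , refl , refl) = sym (upper-match i)
    coco-pol e i (inj₂ b) with bot-coco e b
    ... | refl = refl

    contr-pol : ∀ e j → Incident C (contr j) e → polC e ≡ pol₁ (low₁ (suc j))
    contr-pol e j (inj₁ t) with top-contr e t
    ... | refl = refl
    contr-pol e j (inj₂ b) with bot-contr e b
    ... | inj₁ refl = refl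
    ... | inj₂ (inj₁ (refl , b₂)) = trans bridge-match (trans (cong pol₂ (low₂-unique j _ b₂)) (sym (lower-match j)))
    ... | inj₂ (inj₂ ((x , p) , refl , refl)) = sym (lower-match j)

    incident-D″ : ∀ e a → Incident C (in″ a) e → Incident D″ a (ψ e) × polC e ≡ pol₂ (ψ e)
    incident-D″ e a (inj₁ t) with top-in″ e t
    ... | (x , p) , refl , t′ = inj₁ t′ , refl
    incident-D″ e a (inj₂ b) with bot-in″ e b
    ... | inj₁ ((x , p) , refl , b′) = inj₂ b′ , refl
    ... | inj₂ (refl , b₂)           = inj₂ b₂ , bridge-match

    polarisedC : Polarised C polC
    polarisedC (in′ a) e e′ i i′ e≢e′ with incident-D′ e a i | incident-D′ e′ a i′
    ... | x , refl , j | x′ , refl , j′ =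
      PolRel-reindex {A = D′} {B = C} (D₁.kind a) (proj₂ I₁.polarity a x x′ j j′ (λ eq → e≢e′ (cong in′ eq)))
    polarisedC (in″ a) e e′ i i′ e≢e′ with incident-D″ e a i | incident-D″ e′ a i′
    ... | j , pe | j′ , pe′ =
      subst₂ (PolRel C (D₂.kind a)) (sym pe) (sym pe′)
        (PolRel-reindex {A = D″} {B = C} (D₂.kind a)
          (proj₂ I₂.polarity a (ψ e) (ψ e′) j j′ (λ eq → e≢e′ (ψ-injective e e′ a i i′ eq))))
    polarisedC (coco i)  e e′ j j′ _ = trans (coco-pol e i j) (sym (coco-pol e′ i j′))
    polarisedC (contr i) e e′ j j′ _ = trans (contr-pol e i j) (sym (contr-pol e′ i j′))

    isFlowC : IsFlow C
    isFlowC = record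
      { finiteV     = verticesC , verticesC-complete
      ; finiteE     = edgesC , edgesC-complete
      ; upperArity  = upperC
      ; lowerArity  = lowerC
      ; inE-top     = λ i → refl
      ; inE-unique  = λ i e t → top-boundary e t
      ; lowerLabels = λ j → contr j , refl , λ e b → bot-boundary e b
      ; acyclic     = acyclicC
      ; polarity    = polC , polarisedC
      }

    private
      module FC = FlowFacts C isFlowC

    -- a new (co)contraction has a boundary edge, so no ai-path passes it
    coco-impassable : ∀ {i} → FC.Impassable (coco i)
    coco-impassable {e = e} {d = down} (t , b) _ _ with bot-coco e b
    ... | refl = inj₂≢inj₁ t
    coco-impassable {d = up} {down} _ () _
    coco-impassable {e′ = e′} {d = up} {up} _ _ (b′ , t′) with bot-coco e′ b′
    ... | refl = inj₂≢inj₁ t′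

    contr-impassable : ∀ {j} → FC.Impassable (contr j)
    contr-impassable {e = e} {d = up} (b , t) _ _ with top-contr e t
    ... | refl = inj₂≢inj₁ b
    contr-impassable {d = down} {up} _ () _
    contr-impassable {e′ = e′} {d = down} {down} _ _ (t′ , b′) with top-contr e′ t′
    ... | refl = inj₂≢inj₁ b′

    InCopy : GV → Set
    InCopy (in′ _)          = ⊤
    InCopy (in″ _)          = ⊤
    InCopy (inj₂ (inj₂ _)) = ⊥

    passed-in-copy : ∀ {e e′ x y} z {d d₁ : Dir C} → Trav C e d x z → Turn C d z d₁ → Trav C e′ d₁ z y → InCopy z
    passed-in-copy (in′ _)   _ _  _  = tt
    passed-in-copy (in″ _)   _ _  _  = tt
    passed-in-copy (coco _)  t tn t′ = coco-impassable t tn t′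
    passed-in-copy (contr _) t tn t′ = contr-impassable t tn t′

    -- which copy a vertex lies in (false: D′, true: D″); only the bridge
    -- joins the two copies
    side : GV → Bool
    side (in′ _) = false
    side (inj₂ _) = true

    atLower0 : D₁.V ⊎ Fin (suc k) → Bool
    atLower0 (inj₂ zero) = true
    atLower0 _           = false

    isBridge : GE → Bool
    isBridge (in′ x)  = atLower0 (D₁.bot x)
    isBridge (inj₂ _) = false

    isBridge-true : ∀ e → isBridge e ≡ true → e ≡ bridge
    isBridge-true (in′ x) eq = cong in′ (low₁-unique zero x (at0 (D₁.bot x) eq))
      where
      at0 : ∀ y → atLower0 y ≡ true → y ≡ inj₂ zero
      at0 (inj₂ zero) _ = refl
    isBridge-true (inj₂ _) ()

    isBridge-bridge : isBridge bridge ≡ true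
    isBridge-bridge = cong atLower0 (low₁-bot zero)

    isBridge-false : ∀ {e} → e ≢ bridge → isBridge e ≡ false
    isBridge-false {e} e≢bridge with isBridge e in eq
    ... | false = refl
    ... | true  = ⊥-elim (e≢bridge (isBridge-true e eq))

    end-side : ∀ e {a b} → gtop e ≡ inj₁ a → gbot e ≡ inj₁ b → InCopy a → InCopy b → side b ≡ side a xor isBridge e
    end-side (in′ x) {in′ _} {in′ _} _ b _ _ = sym (cong atLower0 (gbot₁-in′ (D₁.bot x) b))
    end-side (in′ x) {in′ _} {in″ _} _ b _ _ = sym (cong atLower0 (proj₁ (gbot₁-in″ (D₁.bot x) b)))
    end-side (in′ x) {in″ _} t _ _ _ = ⊥-elim (gtop₁-in″ (D₁.top x) t)
    end-side (in″ (x , p)) {in′ _} t _ _ _ = ⊥-elim (gtop₂-in′ (D₂.top x) p t)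
    end-side (in″ (x , p)) {in″ _} {in′ _} _ b _ _ = ⊥-elim (fromBot₂-in′ (D₂.bot x) b)
    end-side (in″ (x , p)) {in″ _} {in″ _} _ _ _ _ = refl
    end-side (coco _)  () _ _ _
    end-side (contr _) _ () _ _

    trav-side : ∀ {e x y} {d : Dir C} → Trav C e d x y → InCopy x → InCopy y → side y ≡ side x xor isBridge e
    trav-side {e} {d = down} (t , b) ix iy = end-side e t b ix iy
    trav-side {e} {x} {y} {d = up} (b , t) ix iy = begin
      side y                                 ≡⟨ sym (xor-identityʳ (side y)) ⟩
      side y xor false                       ≡⟨ cong (side y xor_) (sym (xor-same (isBridge e))) ⟩
      side y xor (isBridge e xor isBridge e) ≡⟨ sym (xor-assoc (side y) _ _) ⟩
      (side y xor isBridge e) xor isBridge e ≡⟨ cong (_xor isBridge e) (sym (end-side e t b iy ix)) ⟩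
      side x xor isBridge e                  ∎
      where open ≡-Reasoning

    crossings : List GE → Bool
    crossings []       = false
    crossings (e ∷ es) = isBridge e xor crossings es

    path-side : ∀ {x d y d′ es} → AIPath C x d y d′ es → InCopy x → InCopy y → side y ≡ side x xor crossings es
    path-side {x} ([_] {e = e} t) ix iy = trans (trav-side t ix iy) (cong (side x xor_) (sym (xor-identityʳ (isBridge e))))
    path-side {x} (_∷⟨_⟩_ {y = z} {e = e} {es = es} t tn q) ix iy = begin
      side _                                   ≡⟨ path-side q iz iy ⟩
      side z xor crossings es                  ≡⟨ cong (_xor crossings es) (trav-side t ix iz) ⟩
      (side x xor isBridge e) xor crossings es ≡⟨ xor-assoc (side x) _ _ ⟩
      side x xor (isBridge e xor crossings es) ∎
      where
      open ≡-Reasoning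
      iz : InCopy z
      iz = passed-in-copy z t tn (proj₂ (FC.firstTrav q))

    -- a closed path crosses the bridge an even number of times
    closed-even : ∀ b c → b ≡ b xor c → c ≡ false
    closed-even false c eq = sym eq
    closed-even true false _ = refl
    closed-even true true ()

    no-bridge-no-crossing : ∀ {es} → bridge ∉ es → crossings es ≡ false
    no-bridge-no-crossing {[]} _ = refl
    no-bridge-no-crossing {e ∷ es} ∉ =
      cong₂ _xor_ (isBridge-false (λ e≡bridge → ∉ (here (sym e≡bridge)))) (no-bridge-no-crossing (λ m → ∉ (there m)))

    even-crossings : ∀ {es} → Unique es → crossings es ≡ false → bridge ∉ es
    even-crossings (e∉es ∷ u) even (here refl) =
      true≢false (trans (sym (cong₂ _xor_ isBridge-bridge (no-bridge-no-crossing (λ m → All.lookup e∉es m refl)))) even)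
      where
      true≢false : true ≢ false
      true≢false ()
    even-crossings {e ∷ es} (e∉es ∷ u) even (there m) =
      even-crossings u (trans (sym (cong (_xor crossings es) e-not-bridge)) even) m
      where
      e-not-bridge : isBridge e ≡ false
      e-not-bridge = isBridge-false (All.lookup e∉es m)

    trav-D′ : ∀ {e a b} {d : Dir C} → Trav C e d (in′ a) (in′ b) → Σ D₁.E λ x → e ≡ in′ x × Trav D′ x (reDir d) a b
    trav-D′ {e} {d = down} (t , b) with top-in′ e t
    ... | x , refl , t′ = x , refl , t′ , gbot₁-in′ (D₁.bot x) b
    trav-D′ {e} {d = up} (b , t) with top-in′ e t
    ... | x , refl , t′ = x , refl , gbot₁-in′ (D₁.bot x) b , t′

    trav-D″ : ∀ {e a b} {d : Dir C} → Trav C e d (in″ a) (in″ b)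
            → Σ E₂ λ x′ → e ≡ in″ x′ × Trav D″ (Sub.val x′) (reDir d) a b
    trav-D″ {e} {d = down} (t , b) with top-in″ e t
    ... | (x , p) , refl , t′ = (x , p) , refl , t′ , fromBot₂-in″ (D₂.bot x) b
    trav-D″ {e} {d = up} (b , t) with top-in″ e t
    ... | (x , p) , refl , t′ = (x , p) , refl , fromBot₂-in″ (D₂.bot x) b , t′

    turn-D′ : ∀ {a} {d d₁ : Dir C} → Turn C d (in′ a) d₁ → Turn D′ (reDir d) a (reDir d₁)
    turn-D′ {d = down} {down} tn = tt
    turn-D′ {d = up}   {up}   tn = tt
    turn-D′ {d = down} {up}   tn = tn
    turn-D′ {d = up}   {down} tn = tn

    turn-D″ : ∀ {a} {d d₁ : Dir C} → Turn C d (in″ a) d₁ → Turn D″ (reDir d) a (reDir d₁)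
    turn-D″ {d = down} {down} tn = tt
    turn-D″ {d = up}   {up}   tn = tt
    turn-D″ {d = down} {up}   tn = tn
    turn-D″ {d = up}   {down} tn = tn

    within-D′ : ∀ {a d b d′ es} → AIPath C (in′ a) d (in′ b) d′ es → bridge ∉ es
              → Σ (List D₁.E) λ es₁ → AIPath D′ a (reDir d) b (reDir d′) es₁ × map in′ es₁ ≡ es
    within-D′ [ t ] _ with trav-D′ t
    ... | x , refl , t′ = x ∷ [] , [ t′ ] , refl
    within-D′ (_∷⟨_⟩_ {y = in′ _} t tn q) ∉ with trav-D′ t | within-D′ q (λ m → ∉ (there m))
    ... | x , refl , t′ | es₁ , q′ , refl = x ∷ es₁ , t′ ∷⟨ turn-D′ tn ⟩ q′ , refl
    within-D′ (_∷⟨_⟩_ {y = in″ _} t tn q) ∉ with trans (trav-side t tt tt) (isBridge-false (λ e≡b → ∉ (here (sym e≡b))))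
    ... | ()
    within-D′ (_∷⟨_⟩_ {y = inj₂ (inj₂ z)} t tn q) _ = ⊥-elim (passed-in-copy (inj₂ (inj₂ z)) t tn (proj₂ (FC.firstTrav q)))

    within-D″ : ∀ {a d b d′ es} → AIPath C (in″ a) d (in″ b) d′ es → bridge ∉ es
              → Σ (List E₂) λ es₂ → AIPath D″ a (reDir d) b (reDir d′) (map Sub.val es₂) × map (λ x → in″ x) es₂ ≡ es
    within-D″ [ t ] _ with trav-D″ t
    ... | x , refl , t′ = x ∷ [] , [ t′ ] , refl
    within-D″ (_∷⟨_⟩_ {y = in″ _} t tn q) ∉ with trav-D″ t | within-D″ q (λ m → ∉ (there m))
    ... | x , refl , t′ | es₂ , q′ , refl = x ∷ es₂ , t′ ∷⟨ turn-D″ tn ⟩ q′ , refl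
    within-D″ (_∷⟨_⟩_ {y = in′ _} t tn q) ∉ with trans (trav-side t tt tt) (cong not (isBridge-false (λ e≡b → ∉ (here (sym e≡b)))))
    ... | ()
    within-D″ (_∷⟨_⟩_ {y = inj₂ (inj₂ z)} t tn q) _ = ⊥-elim (passed-in-copy (inj₂ (inj₂ z)) t tn (proj₂ (FC.firstTrav q)))

    coco-leaves-down : ∀ {e i z} {d : Dir C} → Trav C e d (coco i) z → d ≡ down
    coco-leaves-down {d = down} _ = refl
    coco-leaves-down {e} {d = up} (b , t) with bot-coco e b
    ... | refl = ⊥-elim (inj₂≢inj₁ t)

    coco-enters-up : ∀ {e i z} {d : Dir C} → Trav C e d z (coco i) → d ≡ up
    coco-enters-up {d = up} _ = refl
    coco-enters-up {e} {d = down} (t , b) with bot-coco e b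
    ... | refl = ⊥-elim (inj₂≢inj₁ t)

    contr-leaves-up : ∀ {e j z} {d : Dir C} → Trav C e d (contr j) z → d ≡ up
    contr-leaves-up {d = up} _ = refl
    contr-leaves-up {e} {d = down} (t , b) with top-contr e t
    ... | refl = ⊥-elim (inj₂≢inj₁ b)

    contr-enters-down : ∀ {e j z} {d : Dir C} → Trav C e d z (contr j) → d ≡ down
    contr-enters-down {d = down} _ = refl
    contr-enters-down {e} {d = up} (b , t) with top-contr e t
    ... | refl = ⊥-elim (inj₂≢inj₁ b)

    cycle-freeC : CycleFree D′ → CycleFree D″ → CycleFree C
    cycle-freeC cf₁ cf₂ record { start = in′ a ; path = p ; distinct = u }
      with within-D′ p (even-crossings u (closed-even _ _ (path-side p tt tt)))
    ... | es₁ , p₁ , refl = cf₁ record { start = a ; d₁ = _ ; d₂ = _ ; edges = es₁ ; path = p₁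
                                       ; distinct = Unique.map⁻ u }
    cycle-freeC cf₁ cf₂ record { start = in″ a ; path = p ; distinct = u }
      with within-D″ p (even-crossings u (closed-even _ _ (path-side p tt tt)))
    ... | es₂ , p₂ , refl = cf₂ record { start = a ; d₁ = _ ; d₂ = _ ; edges = map Sub.val es₂ ; path = p₂
                                       ; distinct = Unique.map⁺ Sub-≡ (Unique.map⁻ u) }
    cycle-freeC cf₁ cf₂ c@record { start = coco i ; d₁ = d₁ ; d₂ = d₂ ; path = p } =
      FC.no-reversing-cycle-at c (inj₂ refl) reverses
      where
      reverses : changes d₁ d₂ ≡ true
      reverses rewrite coco-leaves-down (proj₂ (FC.firstTrav p)) | coco-enters-up (proj₂ (FC.lastTrav p)) = refl
    cycle-freeC cf₁ cf₂ c@record { start = contr j ; d₁ = d₁ ; d₂ = d₂ ; path = p } =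
      FC.no-reversing-cycle-at c (inj₁ refl) reverses
      where
      reverses : changes d₁ d₂ ≡ true
      reverses rewrite contr-leaves-up (proj₂ (FC.firstTrav p)) | contr-enters-down (proj₂ (FC.lastTrav p)) = refl

-- The induction

-- the conclusion of the theorem for B, together with the invariant that C
-- has the same polarities as B on corresponding boundary edges
record Broken {h k : ℕ} (B : Raw h k) (wf : IsFlow B) : Set₁ where
  field
    C         : Raw h k
    isFlow    : IsFlow C
    cycleFree : CycleFree C
    reduction : B →bc C
    upper-pol : ∀ i → polarityOf isFlow (Raw.inE C i) ≡ polarityOf wf (Raw.inE B i)
    lower-pol : ∀ j e e′ → Raw.bot B e ≡ inj₂ j → Raw.bot C e′ ≡ inj₂ j → polarityOf wf e ≡ polarityOf isFlow e′

unbroken : ∀ {h k} (B : Raw h k) (wf : IsFlow B) → CycleFree B → Broken B wf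
unbroken B wf cf = record
  { C = B ; isFlow = wf ; cycleFree = cf ; reduction = base (λ fragile → cf (proj₁ fragile))
  ; upper-pol = λ i → refl
  ; lower-pol = λ j e e′ b b′ → cong (polarityOf wf) (exactlyOne-unique (IsFlow.lowerLabels wf j) b b′) }

glue-step : ∀ {h k} (B : Raw h k) (wf : IsFlow B) (sd : SimpleEdgeData B) → let open SimpleEdgeData sd in
            (Σ (AICycle B) λ c → e1 ∈ AICycle.edges c)
          → Broken (WeakenedCopy.B′ B wf sd) (WeakenedCopy.isFlow′ B wf sd)
          → Broken (CoweakenedCopy.B″ B wf sd) (CoweakenedCopy.isFlow″ B wf sd)
          → Broken B wf
glue-step B wf sd onCycle r′ r″ = record
  { C = Glued.C D′ D″ wf₁ wf₂
  ; isFlow = Glued.isFlowC D′ D″ wf₁ wf₂ match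
  ; cycleFree = Glued.cycle-freeC D′ D″ wf₁ wf₂ match (Broken.cycleFree r′) (Broken.cycleFree r″)
  ; reduction = step wf u w e1 e2 hu hw t1 b1 t2 e2≢e1 onCycle (Broken.reduction r′) (Broken.reduction r″)
  ; upper-pol = Broken.upper-pol r′
  ; lower-pol = lower-pol
  }
  where
  open Raw B
  open SimpleEdgeData sd
  module W = WeakenedCopy B wf sd
  module CW = CoweakenedCopy B wf sd
  open Broken r′ using () renaming (C to D′; isFlow to wf₁)
  open Broken r″ using () renaming (C to D″; isFlow to wf₂)
  open Glued D′ D″ wf₁ wf₂ using (pol₁; pol₂; low₁; low₁-bot; low₂; low₂-bot; PolarityMatch; bot-boundary)
  pol : E → Bool
  pol = polarityOf wf

  edge2-pol : pol e2 ≡ not (pol e1)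
  edge2-pol = ¬-not (λ eq → subst (λ κ → PolRel B κ (pol e1) (pol e2)) hu
                (proj₂ (IsFlow.polarity wf) u e1 e2 (inj₁ t1) (inj₁ t2) (λ eq′ → e2≢e1 (sym eq′))) (sym eq))

  edge3-pol : pol e3 ≡ not (pol e1)
  edge3-pol = ¬-not (λ eq → subst (λ κ → PolRel B κ (pol e1) (pol e3)) hw
                (proj₂ (IsFlow.polarity wf) w e1 e3 (inj₂ b1) (inj₂ b3) (λ eq′ → e3≢e1 (sym eq′))) (sym eq))

  match : PolarityMatch
  match = record
    { upper-match  = λ i → trans (Broken.upper-pol r′ i) (sym (Broken.upper-pol r″ (suc i)))
    ; lower-match  = lower-match
    ; bridge-match = begin
        pol₁ (low₁ zero)      ≡⟨ sym (Broken.lower-pol r′ zero (e3 , e3≢e1) (low₁ zero) (W.bot′-new⁺ e3 e3≢e1 b3) (low₁-bot zero)) ⟩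
        pol e3                ≡⟨ trans edge3-pol (sym edge2-pol) ⟩
        pol e2                ≡⟨ sym (Broken.upper-pol r″ zero) ⟩
        pol₂ (Raw.inE D″ zero) ∎
    }
    where
    open ≡-Reasoning
    lower-match : ∀ j → pol₁ (low₁ (suc j)) ≡ pol₂ (low₂ j)
    lower-match j with IsFlow.lowerLabels wf j
    ... | ℓ , bℓ , _ = trans (sym (Broken.lower-pol r′ (suc j) (ℓ , boundary≢e1 bℓ) (low₁ (suc j))
                                    (W.bot′-old⁺ ℓ _ j bℓ) (low₁-bot (suc j))))
                             (Broken.lower-pol r″ j (ℓ , boundary≢e1 bℓ) (low₂ j)
                                    (CW.lift-boundary⁺ (bot ℓ) _ j bℓ) (low₂-bot j))

  lower-pol : ∀ j e e′ → bot e ≡ inj₂ j → Raw.bot (Glued.C D′ D″ wf₁ wf₂) e′ ≡ inj₂ j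
            → pol e ≡ Glued.polC D′ D″ wf₁ wf₂ e′
  lower-pol j e e′ b b′ with bot-boundary e′ b′
  ... | refl = Broken.lower-pol r′ (suc j) (e , boundary≢e1 b) (low₁ (suc j)) (W.bot′-old⁺ e _ j b) (low₁-bot (suc j))

-- induction on an upper bound n for the number of vertices
break-cycles : ∀ n {h k} (B : Raw h k) (wf : IsFlow B) → length (proj₁ (IsFlow.finiteV wf)) ≤ n
             → AllCyclesFragile B → Broken B wf
break-cycles n B wf size fragile with FlowFacts.AICycle? B wf
... | no acyclic = unbroken B wf acyclic
break-cycles zero B wf size fragile | yes c
  with <-≤-trans (∈⇒nonempty (proj₂ (IsFlow.finiteV wf) (AICycle.start c))) size
... | ()
break-cycles (suc n) B wf size fragile | yes c with fragile c
... | e , e∈ , simple with simpleEdgeData B wf simple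
...   | sd , refl =
  glue-step B wf sd (c , e∈)
    (break-cycles n _ W.isFlow′ (smaller W.fewer-vertices′) (W.all-fragile′ fragile))
    (break-cycles n _ CW.isFlow″ (smaller CW.fewer-vertices″) (CW.all-fragile″ fragile))
  where
  module W = WeakenedCopy B wf sd
  module CW = CoweakenedCopy B wf sd
  smaller : ∀ {m} → m < length (proj₁ (IsFlow.finiteV wf)) → m ≤ n
  smaller fewer = ≤-pred (<-≤-trans fewer size)

theorem5p9 : ∀ {h k : ℕ} (B : Raw h k) → IsFlow B → AllCyclesFragile B
    → Σ (Raw h k) (λ C → IsFlow C × CycleFree C × B →bc C)
theorem5p9 B wf fragile = C , isFlow , cycleFree , reduction
  where open Broken (break-cycles _ B wf ≤-refl fragile)
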